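{- If $f$ is a conformally indecomposable flow on $(\Sigma,\omega)$, then there exists a directed closed, positive walk $(W,\omega_f)$ on $\Sigma(f)$ such that $f=f_{(W,\,\omega_f)}$. Furthermore, if $(\widetilde{W},\,\widetilde{\omega}_f)$ is a lift of $(W,\,\omega_f)$, then $\widetilde{W}$ is a circle, and $f_{(\widetilde{W},\,\widetilde{\omega}_f)}$ is a lift of $f$ and is a conformally indecomposable flow on $(\widetilde\Sigma,\widetilde\omega)$.
   Context: $\Sigma=(G,\sigma)$ is a signed graph (each edge has sign $\pm1$; loops have two distinguishable ends). An orientation $\omega$ assigns $\pm1$ to each edge end with $\sigma(e)=-\omega(u,e)\omega(v,e)$ for $e$ with endpoints $u,v$. A walk $W=v_0e_1v_1\cdots e_nv_n$ has sign $\prod\sigma(e_i)$; a direction $\omega_W$ of $W$ orients its edges so that it is coherent at internal vertices ($\omega_W(v_i,e_i)+\omega_W(v_i,e_{i+1})=0$), and also at $v_0=v_n$ if the walk is directed closed. An integral flow on $(\Sigma,\omega)$ is $f:E\to\mathbb Z$ with $\sum_{(v,e)\text{ ends at }v}\omega(v,e)f(e)=0$ at every vertex $v$. For a directed walk, $f_{(W,\omega_W)}(e)=\sum_{e_i=e}[\omega,\omega_W](e_i)$, where the coupling $[\omega_1,\omega_2](e)=\omega_1(v,e)\omega_2(v,e)$ ($0$ if $e$ not in both). $\Sigma(f)$ is the subgraph formed by the support of $f$. $\omega_f$ is the orientation equal to $\omega$ on edges with $f(e)\ge0$ and to $-\omega$ on edges with $f(e)<0$. A flow $f$ is conformally indecomposable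 if it is nonzero and not a sum $f_1+f_2$ of two nonzero integral flows with $f_1(e)f_2(e)\ge0$ for all $e$. The double covering graph $\widetilde\Sigma$ has vertices $v^{\pm}$ and edges $\tilde e,\tilde e^*$ for each edge $e$, where an edge $e$ joining $u,v$ lifts to edges joining $u^\alpha$ and $v^{\alpha\sigma(e)}$ for $\alpha=\pm$; the projection $\pi$ sends $v^\alpha\mapsto v$, $\tilde e,\tilde e^*\mapsto e$. The lifted orientation is $\widetilde\omega(v^\alpha,e^\beta)=\alpha\,\omega(v,e)$ (making $(\widetilde\Sigma,\widetilde\omega)$ an ordinary oriented graph), and similarly a direction $\omega_W$ lifts to $\widetilde\omega_W$. A lift of a walk $W$ is $\widetilde W=v_0^{\alpha_0}\tilde e_1v_1^{\alpha_1}\cdots\tilde e_nv_n^{\alpha_n}$ with $\alpha_i=\alpha_{i-1}\sigma(e_i)$, $\tilde e_i$ the lift of $e_i$ joining $v_{i-1}^{\alpha_{i-1}}$ and $v_i^{\alpha_i}$. The projection of $\tilde f:E(\widetilde\Sigma)\to\mathbb Z$ is $\pi(\tilde f)(e)=\tilde f(\tilde e)+\tilde f(\tilde e^*)$, and a lift of a flow $f$ is a flow $\tilde f$ on $(\widetilde\Sigma,\widetilde\omega)$ with $\pi(\tilde f)=f$. A circle is a connected 2-regular subgraph. -}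

module Defs where

open import Data.Bool using (Bool; true; false; not; if_then_else_; T)
open import Data.Nat as ℕ using (ℕ)
open import Data.Integer as ℤ using (ℤ; 0ℤ; _◃_)
open import Data.Sign as S using (Sign)
open import Data.Fin using (Fin; zero; suc; _≟_; splitAt; join)
open import Data.List using (List; []; _∷_; _++_; map)
open import Data.Bool.ListAction using (any)
open import Data.Unit using (⊤)
open import Data.List.Relation.Unary.All using (All)
open import Data.List.Relation.Unary.Unique.Propositional using (Unique)
open import Data.Product using (Σ; _×_; _,_; proj₁; proj₂; ∃)
open import Data.Sum using (_⊎_; inj₁; inj₂)
open import Data.Empty using (⊥)
open import Relation.Nullary using (¬_; does)
open import Relation.Binary.PropositionalEquality using (_≡_; _≢_)

-- Every edge
-- has two distinguishable ends, indexed by a side : Bool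
-- (false = "end 0", true = "end 1"); a loop has both ends at the same
-- vertex.

record SignedGraph : Set where
  field
    nV    : ℕ
    nE    : ℕ
    endpt : Fin nE → Bool → Fin nV
    σ     : Fin nE → Sign

open SignedGraph public

toℤ : Sign → ℤ
toℤ s = s ◃ 1

Σℤ : ∀ {n} → (Fin n → ℤ) → ℤ
Σℤ {ℕ.zero}  g = 0ℤ
Σℤ {ℕ.suc n} g = g zero ℤ.+ Σℤ (λ i → g (suc i))

Σℕ : ∀ {n} → (Fin n → ℕ) → ℕ
Σℕ {ℕ.zero}  g = 0
Σℕ {ℕ.suc n} g = g zero ℕ.+ Σℕ (λ i → g (suc i))

module _ (G : SignedGraph) where

  Vtx : Set
  Vtx = Fin (nV G)

  Edge : Set
  Edge = Fin (nE G)

  EndSigns : Set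
  EndSigns = Edge → Bool → Sign

  IsOrientation : EndSigns → Set
  IsOrientation ω = ∀ e → σ G e ≡ S.opposite (ω e false S.* ω e true)

  IsFlow : EndSigns → (Edge → ℤ) → Set
  IsFlow ω f = ∀ v → Σℤ (λ e →
      (if does (endpt G e false ≟ v) then toℤ (ω e false) ℤ.* f e else 0ℤ)
      ℤ.+ (if does (endpt G e true ≟ v) then toℤ (ω e true) ℤ.* f e else 0ℤ))
      ≡ 0ℤ

  NonZero : (Edge → ℤ) → Set
  NonZero f = ¬ (∀ e → f e ≡ 0ℤ)

  ConfIndecomposable : EndSigns → (Edge → ℤ) → Set
  ConfIndecomposable ω f =
    IsFlow ω f × NonZero f ×
    ¬ (Σ (Edge → ℤ) λ f₁ → Σ (Edge → ℤ) λ f₂ →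
         IsFlow ω f₁ × IsFlow ω f₂ × NonZero f₁ × NonZero f₂ ×
         (∀ e → f e ≡ f₁ e ℤ.+ f₂ e) × (∀ e → 0ℤ ℤ.≤ f₁ e ℤ.* f₂ e))

  orientFlow : EndSigns → (Edge → ℤ) → EndSigns
  orientFlow ω f e s =
    if does (0ℤ ℤ.≤? f e) then ω e s else S.opposite (ω e s)

  -- coupling [ω₁,ω₂](e) = ω₁(v,e) ω₂(v,e)  (independent of the end v for
  -- orientations; we use end 0)
  coupling : EndSigns → EndSigns → Edge → ℤ
  coupling ω₁ ω₂ e = toℤ (ω₁ e false) ℤ.* toℤ (ω₂ e false)

  -- Walks.  A step (e , s) traverses edge e leaving through end s and
  -- entering through end (not s).  A walk is a list of steps.

  Step : Set
  Step = Edge × Bool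

  WalkFromTo : List Step → Vtx → Vtx → Set
  WalkFromTo []            u v = u ≡ v
  WalkFromTo ((e , s) ∷ W) u v = endpt G e s ≡ u × WalkFromTo W (endpt G e (not s)) v

  Coherent : EndSigns → List Step → Set
  Coherent τ []                          = ⊥
  Coherent τ (x ∷ [])                    = ⊤
  Coherent τ ((e , s) ∷ (e′ , s′) ∷ W) =
    toℤ (τ e (not s)) ℤ.+ toℤ (τ e′ s′) ≡ 0ℤ × Coherent τ ((e′ , s′) ∷ W)

  -- (W, τ) is a directed closed walk: W is a (nonempty) closed walk and τ
  -- is coherent at all internal vertices and at v₀ = vₙ
  DirectedClosedWalk : EndSigns → List Step → Set
  DirectedClosedWalk τ []            = ⊥
  DirectedClosedWalk τ ((e , s) ∷ W) =
    WalkFromTo ((e , s) ∷ W) (endpt G e s) (endpt G e s) ×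
    Coherent τ ((e , s) ∷ W ++ (e , s) ∷ [])

  walkSign : List Step → Sign
  walkSign []            = S.+
  walkSign ((e , s) ∷ W) = σ G e S.* walkSign W

  walkFlow : EndSigns → EndSigns → List Step → Edge → ℤ
  walkFlow ω τ []             e = 0ℤ
  walkFlow ω τ ((e′ , s) ∷ W) e =
    (if does (e′ ≟ e) then coupling ω τ e′ else 0ℤ) ℤ.+ walkFlow ω τ W e

  OnSupport : (Edge → ℤ) → List Step → Set
  OnSupport f W = All (λ st → f (proj₁ st) ≢ 0ℤ) W

  edgeSetOf : List Step → Edge → Bool
  edgeSetOf W e = any (λ st → does (proj₁ st ≟ e)) W

  InVertexSet : (Edge → Bool) → Vtx → Set
  InVertexSet P v = Σ Edge λ e → T (P e) × Σ Bool λ s → endpt G e s ≡ v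

  -- degree of v in the subgraph (a loop counts twice)
  degree : (Edge → Bool) → Vtx → ℕ
  degree P v = Σℕ (λ e → if P e
    then (if does (endpt G e false ≟ v) then 1 else 0)
         ℕ.+ (if does (endpt G e true ≟ v) then 1 else 0)
    else 0)

  IsCircle : (Edge → Bool) → Set
  IsCircle P =
    (Σ Vtx λ v → InVertexSet P v) ×
    (∀ v → InVertexSet P v → degree P v ≡ 2) ×
    (∀ u v → InVertexSet P u → InVertexSet P v →
       Σ (List Step) λ W → All (λ st → T (P (proj₁ st))) W × WalkFromTo W u v)

  WalkIsCircle : List Step → Set
  WalkIsCircle W = Unique (map proj₁ W) × IsCircle (edgeSetOf W)

liftFin : ∀ {n} → Sign → Fin n → Fin (n ℕ.+ n)
liftFin {n} S.+ i = join n n (inj₁ i)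
liftFin {n} S.- i = join n n (inj₂ i)

module _ (G : SignedGraph) where

  unliftE : Fin (nE G ℕ.+ nE G) → Sign × Edge G
  unliftE e′ with splitAt (nE G) e′
  ... | inj₁ e = S.+ , e
  ... | inj₂ e = S.- , e

  -- sign of the vertex at end s of the lift e^β: end 0 is u^β, end 1 is v^{βσ(e)}
  sideSign : Edge G → Bool → Sign
  sideSign e false = S.+
  sideSign e true  = σ G e

  -- Σ̃ : edge e joining u (end 0), v (end 1) lifts to ẽ = e^+ joining u^+, v^{σ(e)}
  -- and ẽ* = e^- joining u^-, v^{-σ(e)}; all lifted edges are positive
  doubleCover : SignedGraph
  doubleCover = record
    { nV    = nV G ℕ.+ nV G
    ; nE    = nE G ℕ.+ nE G
    ; endpt = λ e′ s → let (β , e) = unliftE e′ in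
                       liftFin (β S.* sideSign e s) (endpt G e s)
    ; σ     = λ _ → S.+
    }

  -- lifted orientation / direction:  ω̃(v^α, e^β) = α ω(v,e)
  liftEnds : EndSigns G → EndSigns doubleCover
  liftEnds ω e′ s = let (β , e) = unliftE e′ in (β S.* sideSign e s) S.* ω e s

  -- lift of a walk starting at v₀^α
  liftWalk : Sign → List (Step G) → List (Step doubleCover)
  liftWalk α []            = []
  liftWalk α ((e , s) ∷ W) = (liftFin (α S.* sideSign e s) e , s) ∷ liftWalk (α S.* σ G e) W

  project : (Edge doubleCover → ℤ) → Edge G → ℤ
  project f̃ e = f̃ (liftFin S.+ e) ℤ.+ f̃ (liftFin S.- e)

  IsLiftOf : EndSigns G → (Edge doubleCover → ℤ) → (Edge G → ℤ) → Set
  IsLiftOf ω f̃ f = IsFlow doubleCover (liftEnds ω) f̃ × (∀ e → project f̃ e ≡ f e)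

-- Put τ = ω_f. Then f = [ω,τ]·|f|, and |f| is a nonnegative τ-flow. Start along an edge
-- of the support and keep leaving each vertex through an end whose τ-sign cancels the one
-- we arrived with, never using an edge more than |f| times: the unused part of |f| balances
-- the boundary of the walk so far, so the walk can only stop once it has closed up
-- coherently. Its flow f_W is a flow and f − f_W is conformal to it, so f = f_W by
-- indecomposability; coherence makes W positive. If W left some vertex twice with the same
-- τ-sign, the closed subwalk in between would also carry f, with fewer traversals of some
-- edge. Since the sheet of the lift at a vertex is fixed by the τ-sign of departure, the
-- lifts of W visit each vertex once and are circles; a conformal decomposition of the
-- lifted flow would project to one of f.
module Submission where

open import Defs
open import Data.Bool using (Bool; true; false; not; if_then_else_; T; _∨_; _∧_)
open import Data.Empty using (⊥; ⊥-elim)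
open import Data.Fin using (Fin; zero; suc; _≟_; splitAt; _↑ˡ_; _↑ʳ_)
import Data.Fin.Properties as Finₚ
open import Data.Integer as ℤ using (ℤ; 0ℤ; +_; _+_; _*_; -_; _-_; _≤_; ∣_∣)
import Data.Integer.Properties as ℤₚ
open import Data.Integer.Tactic.RingSolver using (solve-∀)
open import Data.List using (List; []; _∷_; _++_; map)
import Data.List.Properties as Listₚ
open import Data.List.Membership.Propositional using (_∈_; find)
open import Data.List.Membership.Propositional.Properties using (∈-map⁺; ∈-map⁻; ∈-++⁺ˡ; ∈-++⁺ʳ; ∈-∃++)
open import Data.List.Relation.Unary.All as All using (All; []; _∷_)
import Data.List.Relation.Unary.All.Properties as Allₚ
open import Data.List.Relation.Unary.AllPairs using ([]; _∷_)
open import Data.List.Relation.Unary.Any as Any using (here; there)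
open import Data.List.Relation.Unary.Any.Properties using (any⁺; any⁻)
open import Data.List.Relation.Unary.Unique.Propositional using (Unique)
open import Data.Nat as ℕ using (ℕ)
open import Data.Nat.ListAction using (sum)
import Data.Nat.Properties as ℕₚ
open import Data.Product as Product using (Σ; _×_; _,_; proj₁; proj₂; ∃; ∃₂)
open import Data.Sign as S using (Sign)
import Data.Sign.Properties as Signₚ
open import Data.Sum using (_⊎_; inj₁; inj₂)
import Data.Sum.Properties as Sumₚ
open import Data.Unit using (⊤; tt)
open import Function using (_∘_)
open import Relation.Binary.PropositionalEquality
open import Relation.Nullary using (¬_; does; yes; no; Dec)
open import Relation.Nullary.Decidable using (dec-true; dec-false; _×-dec_; _⊎-dec_)

open import Algebra.Properties.CommutativeSemigroup ℤₚ.+-commutativeSemigroup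
  using (interchange)
open import Algebra.Properties.CommutativeSemigroup ℕₚ.+-commutativeSemigroup
  using () renaming (interchange to ℕ-interchange)

Σℤ-cong : ∀ {n} {g h : Fin n → ℤ} → (∀ i → g i ≡ h i) → Σℤ g ≡ Σℤ h
Σℤ-cong {ℕ.zero}  eq = refl
Σℤ-cong {ℕ.suc n} eq = cong₂ _+_ (eq zero) (Σℤ-cong (eq ∘ suc))

Σℤ-+ : ∀ {n} (g h : Fin n → ℤ) → Σℤ (λ i → g i + h i) ≡ Σℤ g + Σℤ h
Σℤ-+ {ℕ.zero}  g h = refl
Σℤ-+ {ℕ.suc n} g h = trans (cong (_+_ (g zero + h zero)) (Σℤ-+ (g ∘ suc) (h ∘ suc)))
                           (interchange (g zero) (h zero) _ _)

Σℤ-zero : ∀ n → Σℤ {n} (λ _ → 0ℤ) ≡ 0ℤ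
Σℤ-zero ℕ.zero    = refl
Σℤ-zero (ℕ.suc n) = trans (ℤₚ.+-identityˡ _) (Σℤ-zero n)

Σℤ-neg : ∀ {n} (g : Fin n → ℤ) → Σℤ (λ i → - g i) ≡ - Σℤ g
Σℤ-neg {ℕ.zero}  g = refl
Σℤ-neg {ℕ.suc n} g = trans (cong (_+_ (- g zero)) (Σℤ-neg (g ∘ suc)))
                           (sym (ℤₚ.neg-distrib-+ (g zero) _))

Σℤ-- : ∀ {n} (g h : Fin n → ℤ) → Σℤ (λ i → g i - h i) ≡ Σℤ g - Σℤ h
Σℤ-- g h = trans (Σℤ-+ g (λ i → - h i)) (cong (_+_ (Σℤ g)) (Σℤ-neg h))

Σℤ-*ˡ : ∀ {n} (k : ℤ) (g : Fin n → ℤ) → Σℤ (λ i → k * g i) ≡ k * Σℤ g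
Σℤ-*ˡ {ℕ.zero}  k g = sym (ℤₚ.*-zeroʳ k)
Σℤ-*ˡ {ℕ.suc n} k g = trans (cong (_+_ (k * g zero)) (Σℤ-*ˡ k (g ∘ suc)))
                            (sym (ℤₚ.*-distribˡ-+ k (g zero) _))

Σℤ-nonNegative : ∀ {n} (g : Fin n → ℤ) → (∀ i → 0ℤ ≤ g i) → 0ℤ ≤ Σℤ g
Σℤ-nonNegative {ℕ.zero}  g g≥0 = ℤₚ.≤-refl
Σℤ-nonNegative {ℕ.suc n} g g≥0 = ℤₚ.+-mono-≤ (g≥0 zero) (Σℤ-nonNegative (g ∘ suc) (g≥0 ∘ suc))

Σℤ-indicator : ∀ {n} (a : Fin n) (h : Fin n → ℤ) →
  Σℤ (λ i → if does (a ≟ i) then h i else 0ℤ) ≡ h a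
Σℤ-indicator {ℕ.suc n} zero    h = trans (cong (_+_ (h zero)) (Σℤ-zero n)) (ℤₚ.+-identityʳ _)
Σℤ-indicator {ℕ.suc n} (suc a) h = trans (ℤₚ.+-identityˡ _) (Σℤ-indicator a (h ∘ suc))

Σℤ-↑ : ∀ m n (h : Fin (m ℕ.+ n) → ℤ) →
  Σℤ h ≡ Σℤ (λ i → h (i ↑ˡ n)) + Σℤ (λ j → h (m ↑ʳ j))
Σℤ-↑ ℕ.zero    n h = sym (ℤₚ.+-identityˡ (Σℤ h))
Σℤ-↑ (ℕ.suc m) n h = trans (cong (_+_ (h zero)) (Σℤ-↑ m n (h ∘ suc)))
                           (sym (ℤₚ.+-assoc (h zero) _ _))

Σℕ-cong : ∀ {n} {g h : Fin n → ℕ} → (∀ i → g i ≡ h i) → Σℕ g ≡ Σℕ h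
Σℕ-cong {ℕ.zero}  eq = refl
Σℕ-cong {ℕ.suc n} eq = cong₂ ℕ._+_ (eq zero) (Σℕ-cong (eq ∘ suc))

Σℕ-+ : ∀ {n} (g h : Fin n → ℕ) → Σℕ (λ i → g i ℕ.+ h i) ≡ Σℕ g ℕ.+ Σℕ h
Σℕ-+ {ℕ.zero}  g h = refl
Σℕ-+ {ℕ.suc n} g h = trans (cong ((g zero ℕ.+ h zero) ℕ.+_) (Σℕ-+ (g ∘ suc) (h ∘ suc)))
                           (ℕ-interchange (g zero) (h zero) _ _)

Σℕ-zero : ∀ n → Σℕ {n} (λ _ → 0) ≡ 0
Σℕ-zero ℕ.zero    = refl
Σℕ-zero (ℕ.suc n) = Σℕ-zero n

Σℕ-indicator : ∀ {n} (a : Fin n) (h : Fin n → ℕ) →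
  Σℕ (λ i → if does (a ≟ i) then h i else 0) ≡ h a
Σℕ-indicator {ℕ.suc n} zero    h = trans (cong (h zero ℕ.+_) (Σℕ-zero n)) (ℕₚ.+-identityʳ _)
Σℕ-indicator {ℕ.suc n} (suc a) h = Σℕ-indicator a (h ∘ suc)

Σℕ-≥ : ∀ {n} (g : Fin n → ℕ) i → g i ℕ.≤ Σℕ g
Σℕ-≥ g zero    = ℕₚ.m≤m+n _ _
Σℕ-≥ g (suc i) = ℕₚ.≤-trans (Σℕ-≥ (g ∘ suc) i) (ℕₚ.m≤n+m _ (g zero))

toℤ-* : ∀ s t → toℤ (s S.* t) ≡ toℤ s * toℤ t
toℤ-* s t = ℤₚ.◃-distrib-* s t 1 1

toℤ-square : ∀ s → toℤ s * toℤ s ≡ + 1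
toℤ-square S.- = refl
toℤ-square S.+ = refl

*-opposite : ∀ s t → s S.* S.opposite t ≡ S.opposite (s S.* t)
*-opposite S.- t = refl
*-opposite S.+ t = refl

≢opposite⇒≡ : ∀ s t → s ≢ S.opposite t → s ≡ t
≢opposite⇒≡ S.- S.- _ = refl
≢opposite⇒≡ S.+ S.+ _ = refl
≢opposite⇒≡ S.- S.+ s≢-t = ⊥-elim (s≢-t refl)
≢opposite⇒≡ S.+ S.- s≢-t = ⊥-elim (s≢-t refl)

opposite-* : ∀ s t → S.opposite s S.* t ≡ S.opposite (s S.* t)
opposite-* S.- t = sym (Signₚ.opposite-involutive t)
opposite-* S.+ t = refl

opposite-*-opposite : ∀ s t → S.opposite s S.* S.opposite t ≡ s S.* t
opposite-*-opposite S.- t = refl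
opposite-*-opposite S.+ t = Signₚ.opposite-involutive t

nonNegative-summand : ∀ x y → 0ℤ ≤ x * y → 0ℤ ≤ x + y → 0ℤ ≤ x
nonNegative-summand (+ m)      y         _  _  = ℤ.+≤+ ℕ.z≤n
nonNegative-summand ℤ.-[1+ m ] (+ 0)     _  ()
nonNegative-summand ℤ.-[1+ m ] ℤ.+[1+ n ] () _
nonNegative-summand ℤ.-[1+ m ] ℤ.-[1+ n ] _  ()

module _ (u : ℤ) (u*u≡1 : u * u ≡ + 1) where

  unit-*-cancel : ∀ x → u * (u * x) ≡ x
  unit-*-cancel x = trans (sym (ℤₚ.*-assoc u u x)) (trans (cong (_* x) u*u≡1) (ℤₚ.*-identityˡ x))

  unit-*-injective : ∀ {x y} → u * x ≡ u * y → x ≡ y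
  unit-*-injective {x} {y} eq = trans (sym (unit-*-cancel x)) (trans (cong (u *_) eq) (unit-*-cancel y))

  unit-*-* : ∀ x y → (u * x) * (u * y) ≡ x * y
  unit-*-* x y = trans (interchange-* u x u y) (trans (cong (_* (x * y)) u*u≡1) (ℤₚ.*-identityˡ _))
    where
    interchange-* : ∀ a b c d → (a * b) * (c * d) ≡ (a * c) * (b * d)
    interchange-* = solve-∀

  unit-*-summand-nonNegative : ∀ x y → 0ℤ ≤ x * y → 0ℤ ≤ u * (x + y) → 0ℤ ≤ u * x
  unit-*-summand-nonNegative x y xy≥0 u[x+y]≥0 = nonNegative-summand (u * x) (u * y)
    (subst (0ℤ ≤_) (sym (unit-*-* x y)) xy≥0)
    (subst (0ℤ ≤_) (ℤₚ.*-distribˡ-+ u x y) u[x+y]≥0)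

*-nonNegative : ∀ {x y} → 0ℤ ≤ x → 0ℤ ≤ y → 0ℤ ≤ x * y
*-nonNegative {+ m} {+ n} _ _ = subst (0ℤ ≤_) (ℤₚ.pos-* m n) (ℤ.+≤+ ℕ.z≤n)

nonNegative-+-≡0 : ∀ {p q} → 0ℤ ≤ p → 0ℤ ≤ q → p + q ≡ 0ℤ → p ≡ 0ℤ
nonNegative-+-≡0 {+ m} {+ n} _ _ p+q≡0 =
  cong +_ (ℕₚ.m+n≡0⇒m≡0 m (ℤₚ.+-injective (trans (ℤₚ.pos-+ m n) p+q≡0)))

*-distribˡ-- : ∀ a b c → a * (b - c) ≡ a * b - a * c
*-distribˡ-- = solve-∀

toℤ-+≡0⇒opposite : ∀ t u → toℤ t + toℤ u ≡ 0ℤ → u ≡ S.opposite t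
toℤ-+≡0⇒opposite S.- S.+ _ = refl
toℤ-+≡0⇒opposite S.+ S.- _ = refl

opposite⇒toℤ-+≡0 : ∀ t u → u ≡ S.opposite t → toℤ t + toℤ u ≡ 0ℤ
opposite⇒toℤ-+≡0 S.- _ refl = refl
opposite⇒toℤ-+≡0 S.+ _ refl = refl

s*[s*t]≡t : ∀ s t → s S.* (s S.* t) ≡ t
s*[s*t]≡t S.- t = Signₚ.opposite-involutive t
s*[s*t]≡t S.+ t = refl

-- read with a , b the ends of one orientation and c , d those of another
other-end : ∀ a b c d → a S.* b ≡ c S.* d → b S.* (a S.* c) ≡ d
other-end a b c d ab≡cd = begin
  b S.* (a S.* c)  ≡⟨ sym (Signₚ.*-assoc b a c) ⟩
  (b S.* a) S.* c  ≡⟨ cong (S._* c) (trans (Signₚ.*-comm b a) ab≡cd) ⟩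
  (c S.* d) S.* c  ≡⟨ Signₚ.*-comm (c S.* d) c ⟩
  c S.* (c S.* d)  ≡⟨ s*[s*t]≡t c d ⟩
  d                ∎
  where open ≡-Reasoning

cancel-middle : ∀ a b c → (a S.* b) S.* (b S.* c) ≡ a S.* c
cancel-middle a b c = begin
  (a S.* b) S.* (b S.* c)  ≡⟨ Signₚ.*-assoc a b (b S.* c) ⟩
  a S.* (b S.* (b S.* c))  ≡⟨ cong (a S.*_) (sym (Signₚ.*-assoc b b c)) ⟩
  a S.* ((b S.* b) S.* c)  ≡⟨ cong (λ z → a S.* (z S.* c)) (Signₚ.s*s≡+ b) ⟩
  a S.* c                  ∎
  where open ≡-Reasoning

δ : ∀ {n} → Fin n → Fin n → ℕ
δ i j = if does (i ≟ j) then 1 else 0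

δ-refl : ∀ {n} (i : Fin n) → δ i i ≡ 1
δ-refl i rewrite dec-true (i ≟ i) refl = refl

decrement : ∀ {n} → (Fin n → ℕ) → Fin n → Fin n → ℕ
decrement r i j = r j ℕ.∸ δ i j

δ+decrement : ∀ {n} (r : Fin n → ℕ) i → 0 ℕ.< r i → ∀ j → δ i j ℕ.+ decrement r i j ≡ r j
δ+decrement r i r>0 j with i ≟ j
... | yes refl = ℕₚ.m+[n∸m]≡n r>0
... | no  _    = refl

-- Divergence, coherent walks and their flows

module _ (H : SignedGraph) where

  source target : Step H → Vtx H
  source (e , s) = endpt H e s
  target (e , s) = endpt H e (not s)

  outSign inSign : EndSigns H → Step H → Sign
  outSign τ (e , s) = τ e s
  inSign  τ (e , s) = τ e (not s)

  count : List (Step H) → Edge H → ℕ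
  count []             e = 0
  count ((e′ , _) ∷ W) e = δ e′ e ℕ.+ count W e

  signAt : Vtx H → Sign → Vtx H → ℤ
  signAt x t v = if does (x ≟ v) then toℤ t else 0ℤ

  incidence : EndSigns H → Vtx H → Edge H → ℤ
  incidence τ v e = signAt (endpt H e false) (τ e false) v + signAt (endpt H e true) (τ e true) v

  divergence : EndSigns H → (Edge H → ℤ) → Vtx H → ℤ
  divergence τ g v = Σℤ (λ e → incidence τ v e * g e)

  private
    if-* : ∀ b (x y : ℤ) → (if b then x * y else 0ℤ) ≡ (if b then x else 0ℤ) * y
    if-* false x y = refl
    if-* true  x y = refl

    flow-summand : ∀ ω (g : Edge H → ℤ) v e →
      (if does (endpt H e false ≟ v) then toℤ (ω e false) * g e else 0ℤ) +
      (if does (endpt H e true ≟ v) then toℤ (ω e true) * g e else 0ℤ)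
      ≡ incidence ω v e * g e
    flow-summand ω g v e =
      trans (cong₂ _+_ (if-* (does (endpt H e false ≟ v)) (toℤ (ω e false)) (g e))
                       (if-* (does (endpt H e true ≟ v)) (toℤ (ω e true)) (g e)))
            (sym (ℤₚ.*-distribʳ-+ (g e) (signAt (endpt H e false) (ω e false) v)
                                                (signAt (endpt H e true) (ω e true) v)))

  isFlow⇒divergence≡0 : ∀ ω (g : Edge H → ℤ) → IsFlow H ω g → ∀ v → divergence ω g v ≡ 0ℤ
  isFlow⇒divergence≡0 ω g flow v = trans (sym (Σℤ-cong (flow-summand ω g v))) (flow v)

  divergence≡0⇒isFlow : ∀ ω (g : Edge H → ℤ) → (∀ v → divergence ω g v ≡ 0ℤ) → IsFlow H ω g
  divergence≡0⇒isFlow ω g div≡0 v = trans (Σℤ-cong (flow-summand ω g v)) (div≡0 v)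

  divergence-cong : ∀ τ {g h} v → (∀ e → g e ≡ h e) → divergence τ g v ≡ divergence τ h v
  divergence-cong τ v eq = Σℤ-cong (λ e → cong (incidence τ v e *_) (eq e))

  divergence-- : ∀ τ (g h : Edge H → ℤ) v →
    divergence τ (λ e → g e - h e) v ≡ divergence τ g v - divergence τ h v
  divergence-- τ g h v =
    trans (Σℤ-cong (λ e → *-distribˡ-- (incidence τ v e) (g e) (h e)))
          (Σℤ-- (λ e → incidence τ v e * g e) (λ e → incidence τ v e * h e))

  isFlow-- : ∀ ω (g h : Edge H → ℤ) → IsFlow H ω g → IsFlow H ω h → IsFlow H ω (λ e → g e - h e)
  isFlow-- ω g h g-flow h-flow = divergence≡0⇒isFlow ω _ λ v →
    trans (divergence-- ω g h v)
          (cong₂ _-_ (isFlow⇒divergence≡0 ω g g-flow v) (isFlow⇒divergence≡0 ω h h-flow v))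

  incidence-step : ∀ τ a v →
    incidence τ v (proj₁ a) ≡ signAt (source a) (outSign τ a) v + signAt (target a) (inSign τ a) v
  incidence-step τ (e , false) v = refl
  incidence-step τ (e , true)  v = ℤₚ.+-comm (signAt (endpt H e false) (τ e false) v) _

  divergence-δ : ∀ τ a (g : Edge H → ℕ) v →
    divergence τ (λ e → + (δ (proj₁ a) e ℕ.+ g e)) v ≡
    (signAt (source a) (outSign τ a) v + signAt (target a) (inSign τ a) v) + divergence τ (+_ ∘ g) v
  divergence-δ τ a g v = begin
    Σℤ (λ e → incidence τ v e * + (δ (proj₁ a) e ℕ.+ g e))
      ≡⟨ Σℤ-cong split ⟩
    Σℤ (λ e → (if does (proj₁ a ≟ e) then incidence τ v e else 0ℤ) + incidence τ v e * + g e)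
      ≡⟨ Σℤ-+ (λ e → if does (proj₁ a ≟ e) then incidence τ v e else 0ℤ)
              (λ e → incidence τ v e * + g e) ⟩
    Σℤ (λ e → if does (proj₁ a ≟ e) then incidence τ v e else 0ℤ) + divergence τ (+_ ∘ g) v
      ≡⟨ cong (_+ divergence τ (+_ ∘ g) v)
              (trans (Σℤ-indicator (proj₁ a) (incidence τ v)) (incidence-step τ a v)) ⟩
    (signAt (source a) (outSign τ a) v + signAt (target a) (inSign τ a) v) + divergence τ (+_ ∘ g) v ∎
    where
    open ≡-Reasoning
    split : ∀ e → incidence τ v e * + (δ (proj₁ a) e ℕ.+ g e) ≡
                  (if does (proj₁ a ≟ e) then incidence τ v e else 0ℤ) + incidence τ v e * + g e
    split e with does (proj₁ a ≟ e)
    ... | true  = trans (ℤₚ.*-distribˡ-+ (incidence τ v e) (+ 1) (+ g e))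
                        (cong (_+ incidence τ v e * + g e) (ℤₚ.*-identityʳ (incidence τ v e)))
    ... | false = sym (ℤₚ.+-identityˡ _)

  Balanced : EndSigns H → (Edge H → ℤ) → Vtx H → Sign → Vtx H → Sign → Set
  Balanced τ g x t y u = ∀ v → divergence τ g v + (signAt x t v + signAt y u v) ≡ 0ℤ

  -- τ is coherent along W, and also at its ends with a preceding end of sign t and a
  -- following end of sign u
  CoherentBetween : EndSigns H → Sign → List (Step H) → Sign → Set
  CoherentBetween τ t []            u = u ≡ S.opposite t
  CoherentBetween τ t ((e , s) ∷ W) u = τ e s ≡ S.opposite t × CoherentBetween τ (τ e (not s)) W u

  signAt-opposite : ∀ x t v → signAt x t v + signAt x (S.opposite t) v ≡ 0ℤ
  signAt-opposite x t v with does (x ≟ v)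
  ... | true  = opposite⇒toℤ-+≡0 t _ refl
  ... | false = refl

  balanced-∷ : ∀ τ e s (g : Edge H → ℕ) t y u v → τ e s ≡ S.opposite t →
    divergence τ (λ e′ → + (δ e e′ ℕ.+ g e′)) v + (signAt (endpt H e s) t v + signAt y u v) ≡
    divergence τ (+_ ∘ g) v + (signAt (endpt H e (not s)) (τ e (not s)) v + signAt y u v)
  balanced-∷ τ e s g t y u v out≡-t = begin
    divergence τ (λ e′ → + (δ e e′ ℕ.+ g e′)) v + (signAt x t v + signAt y u v)
      ≡⟨ cong (_+ (signAt x t v + signAt y u v)) (divergence-δ τ (e , s) g v) ⟩
    (signAt x (τ e s) v + signAt x′ t′ v) + divergence τ (+_ ∘ g) v + (signAt x t v + signAt y u v)
      ≡⟨ regroup (signAt x (τ e s) v) (signAt x′ t′ v) (divergence τ (+_ ∘ g) v) (signAt x t v) (signAt y u v) ⟩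
    (signAt x t v + signAt x (τ e s) v) + (divergence τ (+_ ∘ g) v + (signAt x′ t′ v + signAt y u v))
      ≡⟨ cong (_+ (divergence τ (+_ ∘ g) v + (signAt x′ t′ v + signAt y u v)))
              (trans (cong (λ z → signAt x t v + signAt x z v) out≡-t) (signAt-opposite x t v)) ⟩
    0ℤ + (divergence τ (+_ ∘ g) v + (signAt x′ t′ v + signAt y u v))
      ≡⟨ ℤₚ.+-identityˡ _ ⟩
    divergence τ (+_ ∘ g) v + (signAt x′ t′ v + signAt y u v) ∎
    where
    open ≡-Reasoning
    x  = endpt H e s
    x′ = endpt H e (not s)
    t′ = τ e (not s)
    regroup : ∀ a b d p q → (a + b) + d + (p + q) ≡ (p + a) + (d + (b + q))
    regroup = solve-∀

  balanced-walk : ∀ τ t W u {x y} → WalkFromTo H W x y → CoherentBetween τ t W u →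
    Balanced τ (+_ ∘ count W) x t y u
  balanced-walk τ t [] u {x} refl refl v = begin
    Σℤ (λ e → incidence τ v e * 0ℤ) + (signAt x t v + signAt x (S.opposite t) v)
      ≡⟨ cong₂ _+_ (trans (Σℤ-cong (λ e → ℤₚ.*-zeroʳ (incidence τ v e))) (Σℤ-zero (nE H)))
                   (signAt-opposite x t v) ⟩
    0ℤ ∎
    where open ≡-Reasoning
  balanced-walk τ t ((e , s) ∷ W) u {y = y} (refl , walk) (out≡-t , coh) v =
    trans (balanced-∷ τ e s (count W) t y u v out≡-t) (balanced-walk τ (τ e (not s)) W u walk coh v)

  coherent⇒coherentBetween : ∀ τ a W b → Coherent H τ (a ∷ W ++ b ∷ []) →
    CoherentBetween τ (inSign τ a) W (outSign τ b)
  coherent⇒coherentBetween τ (e , s) []              (e′ , s′) (link , _) =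
    toℤ-+≡0⇒opposite (τ e (not s)) (τ e′ s′) link
  coherent⇒coherentBetween τ (e , s) ((e₂ , s₂) ∷ W) b         (link , coh) =
    toℤ-+≡0⇒opposite (τ e (not s)) (τ e₂ s₂) link , coherent⇒coherentBetween τ (e₂ , s₂) W b coh

  coherentBetween⇒coherent : ∀ τ a W b → CoherentBetween τ (inSign τ a) W (outSign τ b) →
    Coherent H τ (a ∷ W ++ b ∷ [])
  coherentBetween⇒coherent τ (e , s) []              (e′ , s′) in≡-out =
    opposite⇒toℤ-+≡0 (τ e (not s)) (τ e′ s′) in≡-out , _
  coherentBetween⇒coherent τ (e , s) ((e₂ , s₂) ∷ W) b         (in≡-out , coh) =
    opposite⇒toℤ-+≡0 (τ e (not s)) (τ e₂ s₂) in≡-out , coherentBetween⇒coherent τ (e₂ , s₂) W b coh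

  directedClosedWalk⁻ : ∀ τ a W → DirectedClosedWalk H τ (a ∷ W) →
    WalkFromTo H W (target a) (source a) × CoherentBetween τ (inSign τ a) W (outSign τ a)
  directedClosedWalk⁻ τ (e , s) W ((_ , walk) , coh) = walk , coherent⇒coherentBetween τ (e , s) W (e , s) coh

  directedClosedWalk⁺ : ∀ τ a W → WalkFromTo H W (target a) (source a) →
    CoherentBetween τ (inSign τ a) W (outSign τ a) → DirectedClosedWalk H τ (a ∷ W)
  directedClosedWalk⁺ τ (e , s) W walk coh = (refl , walk) , coherentBetween⇒coherent τ (e , s) W (e , s) coh

  walk-source : ∀ a W {x y} → WalkFromTo H (a ∷ W) x y → source a ≡ x
  walk-source (e , s) W (src≡x , _) = src≡x

  walk-++ : ∀ A {B x y z} → WalkFromTo H A x y → WalkFromTo H B y z → WalkFromTo H (A ++ B) x z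
  walk-++ []            refl           walkB = walkB
  walk-++ ((e , s) ∷ A) (src≡x , walk) walkB = src≡x , walk-++ A walk walkB

  walk-split : ∀ A {B x z} → WalkFromTo H (A ++ B) x z →
    ∃ λ y → WalkFromTo H A x y × WalkFromTo H B y z
  walk-split []            walk           = _ , refl , walk
  walk-split ((e , s) ∷ A) (src≡x , walk) with walk-split A walk
  ... | y , walkA , walkB = y , (src≡x , walkA) , walkB

  coherentBetween-++⁻ : ∀ τ t A b B u → CoherentBetween τ t (A ++ b ∷ B) u →
    CoherentBetween τ t A (outSign τ b) × CoherentBetween τ (inSign τ b) B u
  coherentBetween-++⁻ τ t []            (e , s) B u coh         = coh
  coherentBetween-++⁻ τ t ((e , s) ∷ A) b       B u (link , coh) =
    Product.map₁ (link ,_) (coherentBetween-++⁻ τ (τ e (not s)) A b B u coh)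

  directedClosedWalk⇒closed : ∀ τ W → DirectedClosedWalk H τ W → ∃ λ x → WalkFromTo H W x x
  directedClosedWalk⇒closed τ (_ ∷ _) (walk , _) = _ , walk

  directedClosedWalk⇒coherentBetween : ∀ τ W → DirectedClosedWalk H τ W → ∃₂ λ t u → CoherentBetween τ t W u
  directedClosedWalk⇒coherentBetween τ ((e , s) ∷ W) closed =
    S.opposite (τ e s) , τ e s ,
    sym (Signₚ.opposite-involutive (τ e s)) , proj₂ (directedClosedWalk⁻ τ (e , s) W closed)

  divergence-directedClosedWalk : ∀ τ W → DirectedClosedWalk H τ W → ∀ v →
    divergence τ (+_ ∘ count W) v ≡ 0ℤ
  divergence-directedClosedWalk τ (a ∷ W) closed v = begin
    divergence τ (+_ ∘ count (a ∷ W)) v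
      ≡⟨ divergence-δ τ a (count W) v ⟩
    (signAt (source a) (outSign τ a) v + signAt (target a) (inSign τ a) v) + divergence τ (+_ ∘ count W) v
      ≡⟨ ℤₚ.+-comm _ (divergence τ (+_ ∘ count W) v) ⟩
    divergence τ (+_ ∘ count W) v + (signAt (source a) (outSign τ a) v + signAt (target a) (inSign τ a) v)
      ≡⟨ cong (_+_ (divergence τ (+_ ∘ count W) v)) (ℤₚ.+-comm (signAt (source a) (outSign τ a) v) _) ⟩
    divergence τ (+_ ∘ count W) v + (signAt (target a) (inSign τ a) v + signAt (source a) (outSign τ a) v)
      ≡⟨ balanced-walk τ (inSign τ a) W (outSign τ a) walk coh v ⟩
    0ℤ ∎
    where
    open ≡-Reasoning
    walk = proj₁ (directedClosedWalk⁻ τ a W closed)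
    coh  = proj₂ (directedClosedWalk⁻ τ a W closed)

  σ-orientation : ∀ τ → IsOrientation H τ → ∀ e s → σ H e ≡ S.opposite (τ e s S.* τ e (not s))
  σ-orientation τ τ-or e false = τ-or e
  σ-orientation τ τ-or e true  = trans (τ-or e) (cong S.opposite (Signₚ.*-comm (τ e false) (τ e true)))

  walkSign-coherentBetween : ∀ τ → IsOrientation H τ → ∀ t W u → CoherentBetween τ t W u →
    walkSign H W ≡ S.opposite (t S.* u)
  walkSign-coherentBetween τ τ-or t [] u refl =
    sym (cong S.opposite (Signₚ.s*opposite[s]≡- t))
  walkSign-coherentBetween τ τ-or t ((e , s) ∷ W) u (out≡-t , coh) = begin
    σ H e S.* walkSign H W
      ≡⟨ cong₂ S._*_ (σ-orientation τ τ-or e s) (walkSign-coherentBetween τ τ-or (τ e (not s)) W u coh) ⟩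
    S.opposite (τ e s S.* τ e (not s)) S.* S.opposite (τ e (not s) S.* u)
      ≡⟨ cong (λ z → S.opposite (z S.* τ e (not s)) S.* S.opposite (τ e (not s) S.* u)) out≡-t ⟩
    S.opposite (S.opposite t S.* τ e (not s)) S.* S.opposite (τ e (not s) S.* u)
      ≡⟨ opposite-*-opposite (S.opposite t S.* τ e (not s)) _ ⟩
    (S.opposite t S.* τ e (not s)) S.* (τ e (not s) S.* u)
      ≡⟨ cancel-middle (S.opposite t) (τ e (not s)) u ⟩
    S.opposite t S.* u
      ≡⟨ opposite-* t u ⟩
    S.opposite (t S.* u) ∎
    where open ≡-Reasoning

  walkSign-directedClosedWalk : ∀ τ → IsOrientation H τ → ∀ W → DirectedClosedWalk H τ W →
    walkSign H W ≡ S.+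
  walkSign-directedClosedWalk τ τ-or ((e , s) ∷ W) closed = begin
    walkSign H ((e , s) ∷ W)
      ≡⟨ walkSign-coherentBetween τ τ-or (S.opposite (τ e s)) ((e , s) ∷ W) (τ e s) coh ⟩
    S.opposite (S.opposite (τ e s) S.* τ e s)
      ≡⟨ cong S.opposite (Signₚ.opposite[s]*s≡- (τ e s)) ⟩
    S.+ ∎
    where
    open ≡-Reasoning
    coh = proj₂ (proj₂ (directedClosedWalk⇒coherentBetween τ ((e , s) ∷ W) closed))

  walkFlow-count : ∀ ω τ W e → walkFlow H ω τ W e ≡ coupling H ω τ e * + count W e
  walkFlow-count ω τ []             e = sym (ℤₚ.*-zeroʳ (coupling H ω τ e))
  walkFlow-count ω τ ((e′ , s) ∷ W) e with e′ ≟ e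
  ... | yes refl = trans (cong (_+_ u) (walkFlow-count ω τ W e′))
                         (sym (trans (ℤₚ.*-distribˡ-+ u (+ 1) (+ count W e′))
                                     (cong (_+ u * + count W e′) (ℤₚ.*-identityʳ u))))
    where u = coupling H ω τ e′
  ... | no _     = trans (ℤₚ.+-identityˡ _) (walkFlow-count ω τ W e)

  coupling-sign : ∀ ω τ e → coupling H ω τ e ≡ toℤ (ω e false S.* τ e false)
  coupling-sign ω τ e = sym (toℤ-* (ω e false) (τ e false))

  coupling-square : ∀ ω τ e → coupling H ω τ e * coupling H ω τ e ≡ + 1
  coupling-square ω τ e rewrite coupling-sign ω τ e = toℤ-square (ω e false S.* τ e false)

  signAt-* : ∀ x t k v → signAt x t v * toℤ k ≡ signAt x (t S.* k) v
  signAt-* x t k v with does (x ≟ v)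
  ... | true  = sym (toℤ-* t k)
  ... | false = refl

  incidence-coupling : ∀ ω τ → IsOrientation H ω → IsOrientation H τ → ∀ v e →
    incidence ω v e * coupling H ω τ e ≡ incidence τ v e
  incidence-coupling ω τ ω-or τ-or v e = begin
    incidence ω v e * coupling H ω τ e
      ≡⟨ cong (incidence ω v e *_) (coupling-sign ω τ e) ⟩
    (signAt x₀ (ω e false) v + signAt x₁ (ω e true) v) * toℤ κ
      ≡⟨ ℤₚ.*-distribʳ-+ (toℤ κ) (signAt x₀ (ω e false) v) (signAt x₁ (ω e true) v) ⟩
    signAt x₀ (ω e false) v * toℤ κ + signAt x₁ (ω e true) v * toℤ κ
      ≡⟨ cong₂ _+_ (signAt-* x₀ (ω e false) κ v) (signAt-* x₁ (ω e true) κ v) ⟩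
    signAt x₀ (ω e false S.* κ) v + signAt x₁ (ω e true S.* κ) v
      ≡⟨ cong₂ _+_ (cong (λ z → signAt x₀ z v) (s*[s*t]≡t (ω e false) (τ e false)))
                   (cong (λ z → signAt x₁ z v) (other-end (ω e false) (ω e true) (τ e false) (τ e true) ends)) ⟩
    incidence τ v e ∎
    where
    open ≡-Reasoning
    x₀ = endpt H e false
    x₁ = endpt H e true
    κ  = ω e false S.* τ e false
    ends : ω e false S.* ω e true ≡ τ e false S.* τ e true
    ends = Signₚ.opposite-injective (trans (sym (ω-or e)) (τ-or e))

  divergence-coupling : ∀ ω τ → IsOrientation H ω → IsOrientation H τ → ∀ (g : Edge H → ℤ) v →
    divergence ω (λ e → coupling H ω τ e * g e) v ≡ divergence τ g v
  divergence-coupling ω τ ω-or τ-or g v = Σℤ-cong λ e →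
    trans (sym (ℤₚ.*-assoc (incidence ω v e) (coupling H ω τ e) (g e)))
          (cong (_* g e) (incidence-coupling ω τ ω-or τ-or v e))

  walkFlow-isFlow : ∀ ω τ → IsOrientation H ω → IsOrientation H τ → ∀ W →
    DirectedClosedWalk H τ W → IsFlow H ω (walkFlow H ω τ W)
  walkFlow-isFlow ω τ ω-or τ-or W closed = divergence≡0⇒isFlow ω (walkFlow H ω τ W) λ v → begin
    divergence ω (walkFlow H ω τ W) v
      ≡⟨ divergence-cong ω v (walkFlow-count ω τ W) ⟩
    divergence ω (λ e → coupling H ω τ e * + count W e) v
      ≡⟨ divergence-coupling ω τ ω-or τ-or (+_ ∘ count W) v ⟩
    divergence τ (+_ ∘ count W) v
      ≡⟨ divergence-directedClosedWalk τ W closed v ⟩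
    0ℤ ∎
    where open ≡-Reasoning

  walkFlow-nonZero : ∀ ω τ a W → NonZero H (walkFlow H ω τ (a ∷ W))
  walkFlow-nonZero ω τ (e , s) W walkFlow≡0 = ℕₚ.1+n≢0 (ℤₚ.+-injective count≡0)
    where
    count≡0 : + (1 ℕ.+ count W e) ≡ 0ℤ
    count≡0 = unit-*-injective (coupling H ω τ e) (coupling-square ω τ e) (begin
      coupling H ω τ e * + (1 ℕ.+ count W e)
        ≡⟨ cong (λ n → coupling H ω τ e * + (n ℕ.+ count W e)) (sym (δ-refl e)) ⟩
      coupling H ω τ e * + count ((e , s) ∷ W) e
        ≡⟨ sym (walkFlow-count ω τ ((e , s) ∷ W) e) ⟩
      walkFlow H ω τ ((e , s) ∷ W) e
        ≡⟨ walkFlow≡0 e ⟩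
      0ℤ
        ≡⟨ sym (ℤₚ.*-zeroʳ (coupling H ω τ e)) ⟩
      coupling H ω τ e * 0ℤ ∎)
      where open ≡-Reasoning

  signAt-self : ∀ x t → signAt x t x ≡ toℤ t
  signAt-self x t rewrite dec-true (x ≟ x) refl = refl

  signAt-sameSign⊎opposite : ∀ y x t v → 0ℤ ≤ toℤ y * signAt x t v ⊎ (x ≡ v × t ≡ S.opposite y)
  signAt-sameSign⊎opposite y x t v with x ≟ v
  ... | no _ = inj₁ (ℤₚ.≤-reflexive (sym (ℤₚ.*-zeroʳ (toℤ y))))
  ... | yes x≡v with t Signₚ.≟ S.opposite y
  ...   | yes t≡-y = inj₂ (x≡v , t≡-y)
  ...   | no  t≢-y rewrite ≢opposite⇒≡ t y t≢-y =
    inj₁ (subst (0ℤ ≤_) (sym (toℤ-square y)) (ℤ.+≤+ ℕ.z≤n))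

  private
    end-nonNegative : ∀ y x t n v → ¬ (x ≡ v × t ≡ S.opposite y × 0 ℕ.< n) →
      0ℤ ≤ toℤ y * (signAt x t v * + n)
    end-nonNegative y x t n v ¬exit with signAt-sameSign⊎opposite y x t v
    ... | inj₁ yt≥0 =
      subst (0ℤ ≤_) (ℤₚ.*-assoc (toℤ y) (signAt x t v) (+ n)) (*-nonNegative yt≥0 (ℤ.+≤+ ℕ.z≤n))
    ... | inj₂ (x≡v , t≡-y) with n
    ...   | ℕ.zero  = ℤₚ.≤-reflexive (sym
      (trans (cong (toℤ y *_) (ℤₚ.*-zeroʳ (signAt x t v))) (ℤₚ.*-zeroʳ (toℤ y))))
    ...   | ℕ.suc _ = ⊥-elim (¬exit (x≡v , t≡-y , ℕ.s≤s ℕ.z≤n))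

    unit-balance-absurd : ∀ y D X → 0ℤ ≤ toℤ y * D → 0ℤ ≤ toℤ y * X → D + (toℤ y + X) ≢ 0ℤ
    unit-balance-absurd y D X yD≥0 yX≥0 balance = ℤₚ.<-irrefl (sym total≡0) 0<total
      where
      total≡0 : toℤ y * D + (+ 1 + toℤ y * X) ≡ 0ℤ
      total≡0 = begin
        toℤ y * D + (+ 1 + toℤ y * X)
          ≡⟨ cong (λ z → toℤ y * D + (z + toℤ y * X)) (sym (toℤ-square y)) ⟩
        toℤ y * D + (toℤ y * toℤ y + toℤ y * X)
          ≡⟨ sym (distrib (toℤ y) D X) ⟩
        toℤ y * (D + (toℤ y + X))
          ≡⟨ cong (toℤ y *_) balance ⟩
        toℤ y * 0ℤ
          ≡⟨ ℤₚ.*-zeroʳ (toℤ y) ⟩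
        0ℤ ∎
        where
        open ≡-Reasoning
        distrib : ∀ a d x → a * (d + (a + x)) ≡ a * d + (a * a + a * x)
        distrib = solve-∀
      0<total : 0ℤ ℤ.< toℤ y * D + (+ 1 + toℤ y * X)
      0<total = ℤₚ.+-mono-≤-< yD≥0 (ℤₚ.+-mono-<-≤ (ℤ.+<+ (ℕ.s≤s ℕ.z≤n)) yX≥0)

  module _ (τ : EndSigns H) (v₀ : Vtx H) (a : Sign) where

    ExitsAt : (Edge H → ℕ) → Vtx H → Sign → Edge H → Bool → Set
    ExitsAt r v y e s = endpt H e s ≡ v × τ e s ≡ S.opposite y × 0 ℕ.< r e

    -- y is the sign of τ at the end through which a walk from v₀ entered v, and r is what
    -- remains to be walked; the walk can only be stuck when it has closed up coherently
    noExit⇒closed : ∀ r v y → Balanced τ (+_ ∘ r) v y v₀ a → (∀ e s → ¬ ExitsAt r v y e s) →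
      v ≡ v₀ × a ≡ S.opposite y
    noExit⇒closed r v y balanced noExit with signAt-sameSign⊎opposite y v₀ a v
    ... | inj₂ (v₀≡v , a≡-y) = sym v₀≡v , a≡-y
    ... | inj₁ ya≥0 = ⊥-elim (unit-balance-absurd y D (signAt v₀ a v) yD≥0 ya≥0
                        (trans (cong (λ z → D + (z + signAt v₀ a v)) (sym (signAt-self v y))) (balanced v)))
      where
      D = divergence τ (+_ ∘ r) v
      term≥0 : ∀ e → 0ℤ ≤ toℤ y * (incidence τ v e * + r e)
      term≥0 e = subst (0ℤ ≤_) (sym (distrib (toℤ y) (signAt (endpt H e false) (τ e false) v)
                                               (signAt (endpt H e true) (τ e true) v) (+ r e)))
        (ℤₚ.+-mono-≤ (end-nonNegative y (endpt H e false) (τ e false) (r e) v (noExit e false))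
                     (end-nonNegative y (endpt H e true) (τ e true) (r e) v (noExit e true)))
        where
        distrib : ∀ k p q n → k * ((p + q) * n) ≡ k * (p * n) + k * (q * n)
        distrib = solve-∀
      yD≥0 : 0ℤ ≤ toℤ y * D
      yD≥0 = subst (0ℤ ≤_) (Σℤ-*ˡ (toℤ y) (λ e → incidence τ v e * + r e)) (Σℤ-nonNegative _ term≥0)

    private
      exitsAt? : ∀ r v y e s → Dec (ExitsAt r v y e s)
      exitsAt? r v y e s = (endpt H e s ≟ v) ×-dec (τ e s Signₚ.≟ S.opposite y) ×-dec (0 ℕₚ.<? r e)

    exitingEnd : ∀ r v y → Balanced τ (+_ ∘ r) v y v₀ a → ¬ (v ≡ v₀ × a ≡ S.opposite y) →
      Σ (Edge H) λ e → Σ Bool λ s → ExitsAt r v y e s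
    exitingEnd r v y balanced ¬closed
      with Finₚ.any? (λ e → exitsAt? r v y e false ⊎-dec exitsAt? r v y e true)
    ... | yes (e , inj₁ exit) = e , false , exit
    ... | yes (e , inj₂ exit) = e , true  , exit
    ... | no none = ⊥-elim (¬closed (noExit⇒closed r v y balanced λ where
                      e false exit → none (e , inj₁ exit)
                      e true  exit → none (e , inj₂ exit)))

    ClosingWalk : (Edge H → ℕ) → Vtx H → Sign → Set
    ClosingWalk r v y = Σ (List (Step H)) λ M →
      WalkFromTo H M v v₀ × CoherentBetween τ y M a × (∀ e → count M e ℕ.≤ r e)

    private
      Σℕ-decrement : ∀ (r : Edge H → ℕ) e k → 0 ℕ.< r e → Σℕ r ≡ ℕ.suc k → Σℕ (decrement r e) ≡ k
      Σℕ-decrement r e k r>0 Σr≡1+k = ℕₚ.suc-injective (begin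
        1 ℕ.+ Σℕ (decrement r e)
          ≡⟨ cong (ℕ._+ Σℕ (decrement r e)) (sym (Σℕ-indicator e (λ _ → 1))) ⟩
        Σℕ (δ e) ℕ.+ Σℕ (decrement r e)
          ≡⟨ sym (Σℕ-+ (δ e) (decrement r e)) ⟩
        Σℕ (λ e′ → δ e e′ ℕ.+ decrement r e e′)
          ≡⟨ Σℕ-cong (δ+decrement r e r>0) ⟩
        Σℕ r
          ≡⟨ Σr≡1+k ⟩
        ℕ.suc k ∎)
        where open ≡-Reasoning

      balanced-decrement : ∀ (r : Edge H → ℕ) e s y → τ e s ≡ S.opposite y → 0 ℕ.< r e →
        Balanced τ (+_ ∘ r) (endpt H e s) y v₀ a →
        Balanced τ (+_ ∘ decrement r e) (endpt H e (not s)) (τ e (not s)) v₀ a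
      balanced-decrement r e s y out≡-y r>0 balanced v =
        trans (sym (balanced-∷ τ e s (decrement r e) y v₀ a v out≡-y))
              (trans (cong (_+ (signAt (endpt H e s) y v + signAt v₀ a v))
                           (divergence-cong τ v (λ e′ → cong +_ (δ+decrement r e r>0 e′))))
                     (balanced v))

    mutual
      closingWalk : ∀ k r v y → Σℕ r ≡ k → Balanced τ (+_ ∘ r) v y v₀ a → ClosingWalk r v y
      closingWalk k r v y Σr≡k balanced with (v ≟ v₀) ×-dec (a Signₚ.≟ S.opposite y)
      ... | yes (v≡v₀ , a≡-y) = [] , v≡v₀ , a≡-y , λ _ → ℕ.z≤n
      ... | no ¬closed = continueAlong k r v y Σr≡k balanced (exitingEnd r v y balanced ¬closed)

      continueAlong : ∀ k r v y → Σℕ r ≡ k → Balanced τ (+_ ∘ r) v y v₀ a →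
        (Σ (Edge H) λ e → Σ Bool λ s → ExitsAt r v y e s) → ClosingWalk r v y
      continueAlong ℕ.zero r v y Σr≡0 _ (e , _ , _ , _ , r>0) =
        ⊥-elim (ℕₚ.<⇒≱ r>0 (subst (r e ℕ.≤_) Σr≡0 (Σℕ-≥ r e)))
      continueAlong (ℕ.suc k) r v y Σr≡1+k balanced (e , s , refl , out≡-y , r>0)
        with closingWalk k (decrement r e) (endpt H e (not s)) (τ e (not s))
               (Σℕ-decrement r e k r>0 Σr≡1+k) (balanced-decrement r e s y out≡-y r>0 balanced)
      ... | M , walk , coh , M≤r′ =
        (e , s) ∷ M , (refl , walk) , (out≡-y , coh) ,
        λ e′ → subst (count ((e , s) ∷ M) e′ ℕ.≤_) (δ+decrement r e r>0 e′)
                     (ℕₚ.+-monoʳ-≤ (δ e e′) (M≤r′ e′))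

  directedClosedWalk-within : ∀ τ (c : Edge H → ℕ) → (∀ v → divergence τ (+_ ∘ c) v ≡ 0ℤ) →
    ∀ e → 0 ℕ.< c e → Σ (List (Step H)) λ W →
    DirectedClosedWalk H τ ((e , false) ∷ W) × (∀ e′ → count ((e , false) ∷ W) e′ ℕ.≤ c e′)
  directedClosedWalk-within τ c div≡0 e c>0 =
    close (closingWalk τ x (τ e false) (Σℕ r) r x′ (τ e true) refl balanced)
    where
    x  = endpt H e false
    x′ = endpt H e true
    r  = decrement c e
    balanced : Balanced τ (+_ ∘ r) x′ (τ e true) x (τ e false)
    balanced v = begin
      divergence τ (+_ ∘ r) v + (signAt x′ (τ e true) v + signAt x (τ e false) v)
        ≡⟨ sym (balanced-∷ τ e false r (S.opposite (τ e false)) x (τ e false) v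
                  (sym (Signₚ.opposite-involutive (τ e false)))) ⟩
      divergence τ (λ e′ → + (δ e e′ ℕ.+ r e′)) v
        + (signAt x (S.opposite (τ e false)) v + signAt x (τ e false) v)
        ≡⟨ cong₂ _+_ (trans (divergence-cong τ v (λ e′ → cong +_ (δ+decrement c e c>0 e′))) (div≡0 v))
                     (trans (ℤₚ.+-comm _ (signAt x (τ e false) v)) (signAt-opposite x (τ e false) v)) ⟩
      0ℤ ∎
      where open ≡-Reasoning
    close : ClosingWalk τ x (τ e false) r x′ (τ e true) → Σ (List (Step H)) λ W →
      DirectedClosedWalk H τ ((e , false) ∷ W) × (∀ e′ → count ((e , false) ∷ W) e′ ℕ.≤ c e′)
    close (M , walk , coh , M≤r) = M , directedClosedWalk⁺ τ (e , false) M walk coh ,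
      λ e′ → subst (count ((e , false) ∷ M) e′ ℕ.≤_) (δ+decrement c e c>0 e′)
                   (ℕₚ.+-monoʳ-≤ (δ e e′) (M≤r e′))

  count-∷-≥ : ∀ a W e → count W e ℕ.≤ count (a ∷ W) e
  count-∷-≥ (e′ , _) W e = ℕₚ.m≤n+m (count W e) (δ e′ e)

  count-++ : ∀ A B e → count (A ++ B) e ≡ count A e ℕ.+ count B e
  count-++ []             B e = refl
  count-++ ((e′ , _) ∷ A) B e = trans (cong (δ e′ e ℕ.+_) (count-++ A B e)) (sym (ℕₚ.+-assoc (δ e′ e) _ _))

  onSupport-count : ∀ (f : Edge H → ℤ) W → (∀ e → count W e ℕ.≤ ∣ f e ∣) → OnSupport H f W
  onSupport-count f []            _     = []
  onSupport-count f ((e , s) ∷ W) W≤∣f∣ =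
    f≢0 ∷ onSupport-count f W (λ e′ → ℕₚ.≤-trans (count-∷-≥ (e , s) W e′) (W≤∣f∣ e′))
    where
    f≢0 : f e ≢ 0ℤ
    f≢0 f≡0 = ℕₚ.<⇒≱ (subst (0 ℕ.<_) (cong (ℕ._+ count W e) (sym (δ-refl e))) (ℕ.s≤s ℕ.z≤n))
                      (subst (count ((e , s) ∷ W) e ℕ.≤_) (cong ∣_∣ f≡0) (W≤∣f∣ e))

-- Conformal decompositions

ConformalDecomposition : (H : SignedGraph) → EndSigns H → (Edge H → ℤ) → Set
ConformalDecomposition H ω f = Σ (Edge H → ℤ) λ f₁ → Σ (Edge H → ℤ) λ f₂ →
  IsFlow H ω f₁ × IsFlow H ω f₂ × NonZero H f₁ × NonZero H f₂ ×
  (∀ e → f e ≡ f₁ e + f₂ e) × (∀ e → 0ℤ ≤ f₁ e * f₂ e)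

module _ (G : SignedGraph) (ω : EndSigns G) (f : Edge G → ℤ) where

  orientFlow-isOrientation : IsOrientation G ω → IsOrientation G (orientFlow G ω f)
  orientFlow-isOrientation ω-or e with 0ℤ ℤ.≤? f e
  ... | yes _ = ω-or e
  ... | no  _ = trans (ω-or e) (cong S.opposite (sym (opposite-*-opposite (ω e false) (ω e true))))

  f≡coupling*∣f∣ : ∀ e → f e ≡ coupling G ω (orientFlow G ω f) e * + ∣ f e ∣
  f≡coupling*∣f∣ e with 0ℤ ℤ.≤? f e
  ... | yes f≥0 =
    sym (trans (cong₂ _*_ (toℤ-square (ω e false)) (ℤₚ.0≤i⇒+∣i∣≡i f≥0)) (ℤₚ.*-identityˡ (f e)))
  ... | no  f≱0 = sym (begin
    toℤ (ω e false) * toℤ (S.opposite (ω e false)) * + ∣ f e ∣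
      ≡⟨ cong₂ _*_ (trans (sym (toℤ-* (ω e false) _)) (cong toℤ (Signₚ.s*opposite[s]≡- (ω e false))))
                   ∣f∣≡-f ⟩
    ℤ.-1ℤ * - f e
      ≡⟨ ℤₚ.-1*i≡-i (- f e) ⟩
    - - f e
      ≡⟨ ℤₚ.neg-involutive (f e) ⟩
    f e ∎)
    where
    open ≡-Reasoning
    ∣f∣≡-f : + ∣ f e ∣ ≡ - f e
    ∣f∣≡-f with ℤₚ.+∣i∣≡i⊎+∣i∣≡-i (f e)
    ... | inj₁ ∣f∣≡f  = ⊥-elim (f≱0 (ℤₚ.+∣i∣≡i⇒0≤i ∣f∣≡f))
    ... | inj₂ ∣f∣≡-f = ∣f∣≡-f

  module _ (ω-or : IsOrientation G ω) where

    private
      τ : EndSigns G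
      τ = orientFlow G ω f

      τ-or : IsOrientation G τ
      τ-or = orientFlow-isOrientation ω-or

    divergence-∣f∣ : ∀ v → divergence G τ (λ e → + ∣ f e ∣) v ≡ divergence G ω f v
    divergence-∣f∣ v = sym (trans (divergence-cong G ω v f≡coupling*∣f∣)
                                  (divergence-coupling G ω τ ω-or τ-or (λ e → + ∣ f e ∣) v))

    -- otherwise f = walkFlow + (f − walkFlow) would be a conformal decomposition
    confIndecomposable⇒≡walkFlow : ConfIndecomposable G ω f → ∀ W → DirectedClosedWalk G τ W →
      (∀ e → count G W e ℕ.≤ ∣ f e ∣) → ∀ e → f e ≡ walkFlow G ω τ W e
    confIndecomposable⇒≡walkFlow (f-flow , _ , indecomposable) (a ∷ W) closed W≤∣f∣ =
      decide (Finₚ.all? (λ e → rest e ℤₚ.≟ 0ℤ))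
      where
      f₁ rest : Edge G → ℤ
      f₁   = walkFlow G ω τ (a ∷ W)
      rest = λ e → f e - f₁ e

      conformal : ∀ e → 0ℤ ≤ f₁ e * rest e
      conformal e = subst (0ℤ ≤_) (sym product)
        (*-nonNegative {n} {c - n} (ℤ.+≤+ ℕ.z≤n) (ℤₚ.i≤j⇒0≤j-i (ℤ.+≤+ (W≤∣f∣ e))))
        where
        open ≡-Reasoning
        u = coupling G ω τ e
        n = + count G (a ∷ W) e
        c = + ∣ f e ∣
        product : f₁ e * rest e ≡ n * (c - n)
        product = begin
          f₁ e * (f e - f₁ e)
            ≡⟨ cong₂ (λ p q → p * (q - p)) (walkFlow-count G ω τ (a ∷ W) e) (f≡coupling*∣f∣ e) ⟩
          (u * n) * (u * c - u * n)
            ≡⟨ cong (_*_ (u * n)) (sym (*-distribˡ-- u c n)) ⟩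
          (u * n) * (u * (c - n))
            ≡⟨ unit-*-* u (coupling-square G ω τ e) n (c - n) ⟩
          n * (c - n) ∎

      decide : Dec (∀ e → rest e ≡ 0ℤ) → ∀ e → f e ≡ f₁ e
      decide (yes rest≡0) e = ℤₚ.i-j≡0⇒i≡j (f e) (f₁ e) (rest≡0 e)
      decide (no  rest≢0)   = ⊥-elim (indecomposable
        ( f₁ , rest
        , walkFlow-isFlow G ω τ ω-or τ-or (a ∷ W) closed
        , isFlow-- G ω f f₁ f-flow (walkFlow-isFlow G ω τ ω-or τ-or (a ∷ W) closed)
        , walkFlow-nonZero G ω τ a W , rest≢0
        , (λ e → split (f e) (f₁ e)) , conformal ))
        where
        split : ∀ x y → x ≡ y + (x - y)
        split = solve-∀

    carrierWalk : ConfIndecomposable G ω f → Σ (List (Step G)) λ W →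
      DirectedClosedWalk G τ W × (∀ e → count G W e ℕ.≤ ∣ f e ∣)
    carrierWalk (f-flow , f≢0 , _)
      with Finₚ.¬∀⟶∃¬ (nE G) (λ e → f e ≡ 0ℤ) (λ e → f e ℤₚ.≟ 0ℤ) f≢0
    ... | e , fe≢0 with directedClosedWalk-within G τ (∣_∣ ∘ f)
                          (λ v → trans (divergence-∣f∣ v) (isFlow⇒divergence≡0 G ω f f-flow v))
                          e (ℕₚ.n≢0⇒n>0 (fe≢0 ∘ ℤₚ.∣i∣≡0⇒i≡0))
    ...   | M , closed , bounded = (e , false) ∷ M , closed , bounded

    -- the closed subwalk between the two departures would carry f by itself, with fewer traversals
    departures-distinct : ConfIndecomposable G ω f → ∀ W → DirectedClosedWalk G τ W →
      (∀ e → count G W e ℕ.≤ ∣ f e ∣) → ∀ P q Q r R → W ≡ P ++ q ∷ Q ++ r ∷ R →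
      source G q ≡ source G r → outSign G τ q ≢ outSign G τ r
    departures-distinct ci W closed W≤∣f∣ P (e , s) Q (e′ , s′) R W≡ src≡ out≡ =
      ℕₚ.<-irrefl refl (subst (count G V e′ ℕ.<_) (sym countV≡countW) countV<countW)
      where
      V = (e , s) ∷ Q
      coh : CoherentBetween G τ (τ e (not s)) Q (τ e s)
      coh with directedClosedWalk⇒coherentBetween G τ W closed
      ... | t , u , cohW =
        subst (CoherentBetween G τ (τ e (not s)) Q) (sym out≡)
          (proj₁ (coherentBetween-++⁻ G τ (τ e (not s)) Q (e′ , s′) R u
            (proj₂ (coherentBetween-++⁻ G τ t P (e , s) (Q ++ (e′ , s′) ∷ R) u
              (subst (λ L → CoherentBetween G τ t L u) W≡ cohW)))))
      walk : WalkFromTo G Q (endpt G e (not s)) (endpt G e s)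
      walk with directedClosedWalk⇒closed G τ W closed
      ... | x , walkW with walk-split G P (subst (λ L → WalkFromTo G L x x) W≡ walkW)
      ...   | _ , _ , (_ , walkQR) with walk-split G Q walkQR
      ...     | _ , walkQ , (src′≡z , _) =
        subst (WalkFromTo G Q (endpt G e (not s))) (trans (sym src′≡z) (sym src≡)) walkQ
      counts : ∀ e″ → count G W e″ ≡ count G P e″ ℕ.+ (count G V e″ ℕ.+ count G ((e′ , s′) ∷ R) e″)
      counts e″ = trans (cong (λ L → count G L e″) W≡)
                        (trans (count-++ G P _ e″) (cong (count G P e″ ℕ.+_) (count-++ G V ((e′ , s′) ∷ R) e″)))
      V≤∣f∣ : ∀ e″ → count G V e″ ℕ.≤ ∣ f e″ ∣
      V≤∣f∣ e″ = ℕₚ.≤-trans (ℕₚ.≤-trans (ℕₚ.m≤m+n _ _) (ℕₚ.m≤n+m _ (count G P e″)))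
                            (subst (ℕ._≤ ∣ f e″ ∣) (counts e″) (W≤∣f∣ e″))
      flowOf : ∀ U → DirectedClosedWalk G τ U → (∀ e″ → count G U e″ ℕ.≤ ∣ f e″ ∣) →
        f e′ ≡ coupling G ω τ e′ * + count G U e′
      flowOf U closedU U≤∣f∣ =
        trans (confIndecomposable⇒≡walkFlow ci U closedU U≤∣f∣ e′) (walkFlow-count G ω τ U e′)
      countV≡countW : count G V e′ ≡ count G W e′
      countV≡countW = ℤₚ.+-injective (unit-*-injective (coupling G ω τ e′) (coupling-square G ω τ e′)
        (trans (sym (flowOf V (directedClosedWalk⁺ G τ (e , s) Q walk coh) V≤∣f∣)) (flowOf W closed W≤∣f∣)))
      countV<countW : count G V e′ ℕ.< count G W e′
      countV<countW = begin-strict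
        count G V e′
          <⟨ ℕₚ.m<m+n (count G V e′) (ℕ.s≤s ℕ.z≤n) ⟩
        count G V e′ ℕ.+ ℕ.suc (count G R e′)
          ≡⟨ cong (λ n → count G V e′ ℕ.+ (n ℕ.+ count G R e′)) (sym (δ-refl e′)) ⟩
        count G V e′ ℕ.+ count G ((e′ , s′) ∷ R) e′
          ≤⟨ ℕₚ.m≤n+m _ (count G P e′) ⟩
        count G P e′ ℕ.+ (count G V e′ ℕ.+ count G ((e′ , s′) ∷ R) e′)
          ≡⟨ sym (counts e′) ⟩
        count G W e′ ∎
        where open ℕₚ.≤-Reasoning

-- Closed walks that are circles

T-does : ∀ {n} {i j : Fin n} → T (does (i ≟ j)) → i ≡ j
T-does {i = i} {j} t with i ≟ j
... | yes i≡j = i≡j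

T-does-refl : ∀ {n} (i : Fin n) → T (does (i ≟ i))
T-does-refl i rewrite dec-true (i ≟ i) refl = tt

same-or-flipped : ∀ s s′ → s′ ≡ s ⊎ s′ ≡ not s
same-or-flipped false false = inj₁ refl
same-or-flipped false true  = inj₂ refl
same-or-flipped true  false = inj₂ refl
same-or-flipped true  true  = inj₁ refl

sum-map-+ : ∀ {A : Set} (g h : A → ℕ) xs → sum (map (λ x → g x ℕ.+ h x) xs) ≡ sum (map g xs) ℕ.+ sum (map h xs)
sum-map-+ g h []       = refl
sum-map-+ g h (x ∷ xs) = trans (cong ((g x ℕ.+ h x) ℕ.+_) (sum-map-+ g h xs)) (ℕ-interchange (g x) (h x) _ _)

sum-map-cong : ∀ {A : Set} {g h : A → ℕ} xs → (∀ x → g x ≡ h x) → sum (map g xs) ≡ sum (map h xs)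
sum-map-cong []       eq = refl
sum-map-cong (x ∷ xs) eq = cong₂ ℕ._+_ (eq x) (sum-map-cong xs eq)

occurrences-absent : ∀ {n} (v : Fin n) xs → All (v ≢_) xs → sum (map (λ x → δ x v) xs) ≡ 0
occurrences-absent v []       []            = refl
occurrences-absent v (x ∷ xs) (v≢x ∷ fresh) rewrite dec-false (x ≟ v) (v≢x ∘ sym) =
  occurrences-absent v xs fresh

occurrences-unique : ∀ {n} (v : Fin n) xs → Unique xs → v ∈ xs → sum (map (λ x → δ x v) xs) ≡ 1
occurrences-unique v (x ∷ xs) (fresh ∷ _)    (here refl) = cong₂ ℕ._+_ (δ-refl v) (occurrences-absent v xs fresh)
occurrences-unique v (x ∷ xs) (fresh ∷ uniq) (there v∈) rewrite dec-false (x ≟ v) (All.lookup fresh v∈) =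
  occurrences-unique v xs uniq v∈

unique-map : ∀ {A B : Set} (g : A → B) xs →
  (∀ P x Q y R → xs ≡ P ++ x ∷ Q ++ y ∷ R → g x ≢ g y) → Unique (map g xs)
unique-map g []       distinct = []
unique-map g (x ∷ xs) distinct =
  fresh xs (λ Q y R eq → distinct [] x Q y R (cong (x ∷_) eq)) ∷
  unique-map g xs (λ P x′ Q y R eq → distinct (x ∷ P) x′ Q y R (cong (x ∷_) eq))
  where
  fresh : ∀ ys → (∀ Q y R → ys ≡ Q ++ y ∷ R → g x ≢ g y) → All (g x ≢_) (map g ys)
  fresh []       _        = []
  fresh (y ∷ ys) distinct′ =
    distinct′ [] y ys refl ∷ fresh ys (λ Q y′ R eq → distinct′ (y ∷ Q) y′ R (cong (y ∷_) eq))

module _ (H : SignedGraph) where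

  NoBacktrack : List (Step H) → Set
  NoBacktrack (a ∷ b ∷ W) = ¬ (proj₁ a ≡ proj₁ b × proj₂ b ≡ not (proj₂ a)) × NoBacktrack (b ∷ W)
  NoBacktrack _           = ⊤

  coherentBetween⇒noBacktrack : ∀ τ a W u → CoherentBetween H τ (inSign H τ a) W u → NoBacktrack (a ∷ W)
  coherentBetween⇒noBacktrack τ a               []              u _                 = tt
  coherentBetween⇒noBacktrack τ (e , s) ((e′ , s′) ∷ W) u (out≡-in , coh) =
    backtrack , coherentBetween⇒noBacktrack τ (e′ , s′) W u coh
    where
    backtrack : ¬ (e ≡ e′ × s′ ≡ not s)
    backtrack (refl , refl) = Signₚ.s≢opposite[s] (τ e (not s)) out≡-in

  private
    ends-fresh : ∀ e s W → All (endpt H e s ≢_) (map (source H) W) →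
      All (endpt H e (not s) ≢_) (map (source H) W) → All (e ≢_) (map proj₁ W)
    ends-fresh e s []              _        _        = []
    ends-fresh e s ((e′ , s′) ∷ W) (p ∷ ps) (q ∷ qs) = e≢e′ ∷ ends-fresh e s W ps qs
      where
      e≢e′ : e ≢ e′
      e≢e′ refl with same-or-flipped s s′
      ... | inj₁ refl = p refl
      ... | inj₂ refl = q refl

  -- a step's target is the next step's source, so an edge can only recur by being walked back at once
  uniqueEdges : ∀ W {x y} → WalkFromTo H W x y → Unique (map (source H) W) → NoBacktrack W →
    Unique (map proj₁ W)
  uniqueEdges []                          _           _                      _          = []
  uniqueEdges (_ ∷ [])                    _           _                      _          = [] ∷ []
  uniqueEdges ((e , s) ∷ (e₂ , s₂) ∷ W) (_ , walk) ((p ∷ ps) ∷ qs ∷ u) (nb , nbs) =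
    (e≢e₂ ∷ ends-fresh e s W ps (subst (λ z → All (z ≢_) (map (source H) W)) (proj₁ walk) qs))
    ∷ uniqueEdges ((e₂ , s₂) ∷ W) walk (qs ∷ u) nbs
    where
    e≢e₂ : e ≢ e₂
    e≢e₂ refl with same-or-flipped s s₂
    ... | inj₁ refl = p refl
    ... | inj₂ refl = nb (refl , refl)

  ∈⇒edgeSetOf : ∀ W {a} → a ∈ W → T (edgeSetOf H W (proj₁ a))
  ∈⇒edgeSetOf W {a} a∈W = any⁺ _ (Any.map (λ { refl → T-does-refl (proj₁ a) }) a∈W)

  edgeSetOf⇒∈ : ∀ W e → T (edgeSetOf H W e) → ∃ λ a → a ∈ W × proj₁ a ≡ e
  edgeSetOf⇒∈ W e t with find (any⁻ _ W t)
  ... | a , a∈W , p = a , a∈W , T-does p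

  edgeSetOf-fresh : ∀ W e → All (e ≢_) (map proj₁ W) → edgeSetOf H W e ≡ false
  edgeSetOf-fresh []             e _               = refl
  edgeSetOf-fresh ((e′ , _) ∷ W) e (e≢e′ ∷ fresh) rewrite dec-false (e′ ≟ e) (e≢e′ ∘ sym) =
    edgeSetOf-fresh W e fresh

  Σℕ-edgeSetOf : ∀ W (h : Edge H → ℕ) → Unique (map proj₁ W) →
    Σℕ (λ e → if edgeSetOf H W e then h e else 0) ≡ sum (map (h ∘ proj₁) W)
  Σℕ-edgeSetOf []             h _              = Σℕ-zero (nE H)
  Σℕ-edgeSetOf ((e′ , s) ∷ W) h (fresh ∷ uniq) = begin
    Σℕ (λ e → if does (e′ ≟ e) ∨ edgeSetOf H W e then h e else 0)
      ≡⟨ Σℕ-cong split ⟩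
    Σℕ (λ e → (if does (e′ ≟ e) then h e else 0) ℕ.+ (if edgeSetOf H W e then h e else 0))
      ≡⟨ Σℕ-+ (λ e → if does (e′ ≟ e) then h e else 0) (λ e → if edgeSetOf H W e then h e else 0) ⟩
    Σℕ (λ e → if does (e′ ≟ e) then h e else 0) ℕ.+ Σℕ (λ e → if edgeSetOf H W e then h e else 0)
      ≡⟨ cong₂ ℕ._+_ (Σℕ-indicator e′ h) (Σℕ-edgeSetOf W h uniq) ⟩
    h e′ ℕ.+ sum (map (h ∘ proj₁) W) ∎
    where
    open ≡-Reasoning
    split : ∀ e → (if does (e′ ≟ e) ∨ edgeSetOf H W e then h e else 0) ≡
                  (if does (e′ ≟ e) then h e else 0) ℕ.+ (if edgeSetOf H W e then h e else 0)
    split e with e′ ≟ e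
    ... | yes refl rewrite edgeSetOf-fresh W e′ fresh = sym (ℕₚ.+-identityʳ (h e′))
    ... | no  _    = refl

  target-∈ : ∀ W {x y} → WalkFromTo H W x y → ∀ {a} → a ∈ W →
    target H a ≡ y ⊎ target H a ∈ map (source H) W
  target-∈ ((e , s) ∷ [])            (_ , tgt≡y)       (here refl)  = inj₁ tgt≡y
  target-∈ ((e , s) ∷ (e₂ , s₂) ∷ W) (_ , src₂≡tgt , _) (here refl) = inj₂ (there (here (sym src₂≡tgt)))
  target-∈ ((e , s) ∷ W)             (_ , walk)        (there a∈W) with target-∈ W walk a∈W
  ... | inj₁ tgt≡y = inj₁ tgt≡y
  ... | inj₂ tgt∈  = inj₂ (there tgt∈)

  inVertexSet⇒∈sources : ∀ a W {x} → WalkFromTo H (a ∷ W) x x → ∀ v →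
    InVertexSet H (edgeSetOf H (a ∷ W)) v → v ∈ map (source H) (a ∷ W)
  inVertexSet⇒∈sources a W walk v (e , e∈ , s , end≡v) with edgeSetOf⇒∈ (a ∷ W) e e∈
  ... | (_ , s′) , b∈ , refl with same-or-flipped s′ s
  ...   | inj₁ refl = subst (_∈ map (source H) (a ∷ W)) end≡v (∈-map⁺ (source H) b∈)
  ...   | inj₂ refl with target-∈ (a ∷ W) walk b∈
  ...     | inj₂ tgt∈  = subst (_∈ map (source H) (a ∷ W)) end≡v tgt∈
  ...     | inj₁ tgt≡x = here (trans (sym end≡v) (trans tgt≡x (sym (walk-source H a W walk))))

  private
    sum-targets : ∀ v W {x y} → WalkFromTo H W x y →
      sum (map (λ a → δ (target H a) v) W) ℕ.+ δ x v ≡ sum (map (λ a → δ (source H a) v) W) ℕ.+ δ y v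
    sum-targets v []            refl = refl
    sum-targets v ((e , s) ∷ W) {y = y} (refl , walk) = begin
      (δ x′ v ℕ.+ ins) ℕ.+ δ x v   ≡⟨ ℕₚ.+-comm (δ x′ v ℕ.+ ins) (δ x v) ⟩
      δ x v ℕ.+ (δ x′ v ℕ.+ ins)   ≡⟨ cong (δ x v ℕ.+_) (ℕₚ.+-comm (δ x′ v) ins) ⟩
      δ x v ℕ.+ (ins ℕ.+ δ x′ v)   ≡⟨ cong (δ x v ℕ.+_) (sum-targets v W walk) ⟩
      δ x v ℕ.+ (outs ℕ.+ δ y v)    ≡⟨ sym (ℕₚ.+-assoc (δ x v) outs (δ y v)) ⟩
      (δ x v ℕ.+ outs) ℕ.+ δ y v    ∎
      where
      open ≡-Reasoning
      x  = endpt H e s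
      x′ = endpt H e (not s)
      ins  = sum (map (λ a → δ (target H a) v) W)
      outs  = sum (map (λ a → δ (source H a) v) W)

  -- the edges at v are counted once leaving v and once entering it
  degree-closedWalk : ∀ L {x} → WalkFromTo H L x x → Unique (map (source H) L) → Unique (map proj₁ L) →
    ∀ v → v ∈ map (source H) L → degree H (edgeSetOf H L) v ≡ 2
  degree-closedWalk L {x} walk sources-unique edges-unique v v∈ = begin
    degree H (edgeSetOf H L) v
      ≡⟨ Σℕ-edgeSetOf L (λ e → δ (endpt H e false) v ℕ.+ δ (endpt H e true) v) edges-unique ⟩
    sum (map (λ b → δ (endpt H (proj₁ b) false) v ℕ.+ δ (endpt H (proj₁ b) true) v) L)
      ≡⟨ sum-map-cong L ends ⟩
    sum (map (λ b → δ (source H b) v ℕ.+ δ (target H b) v) L)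
      ≡⟨ sum-map-+ (λ b → δ (source H b) v) (λ b → δ (target H b) v) L ⟩
    outs ℕ.+ ins
      ≡⟨ cong₂ ℕ._+_ outs≡1 (trans (ℕₚ.+-cancelʳ-≡ (δ x v) ins outs (sum-targets v L walk)) outs≡1) ⟩
    2 ∎
    where
    open ≡-Reasoning
    outs = sum (map (λ b → δ (source H b) v) L)
    ins = sum (map (λ b → δ (target H b) v) L)
    ends : ∀ b → δ (endpt H (proj₁ b) false) v ℕ.+ δ (endpt H (proj₁ b) true) v ≡
                 δ (source H b) v ℕ.+ δ (target H b) v
    ends (e , false) = refl
    ends (e , true)  = ℕₚ.+-comm (δ (endpt H e false) v) _
    outs≡1 : outs ≡ 1
    outs≡1 = trans (cong sum (Listₚ.map-∘ L)) (occurrences-unique v (map (source H) L) sources-unique v∈)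

  private
    suffixFrom : ∀ L {x y b} → WalkFromTo H L x y → b ∈ L →
      Σ (List (Step H)) λ M → All (_∈ L) M × WalkFromTo H M (source H b) y
    suffixFrom L {b = b} walk b∈ with ∈-∃++ b∈
    ... | A , B , refl with walk-split H A walk
    ...   | _ , _ , walkB =
      b ∷ B , All.tabulate (∈-++⁺ʳ A) , subst (λ z → WalkFromTo H (b ∷ B) z _) (sym (walk-source H b B walkB)) walkB

    prefixTo : ∀ L {x y b} → WalkFromTo H L x y → b ∈ L →
      Σ (List (Step H)) λ M → All (_∈ L) M × WalkFromTo H M x (source H b)
    prefixTo L {b = b} walk b∈ with ∈-∃++ b∈
    ... | A , B , refl with walk-split H A walk
    ...   | _ , walkA , walkB =
      A , All.tabulate ∈-++⁺ˡ , subst (WalkFromTo H A _) (sym (walk-source H b B walkB)) walkA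

  connected-closedWalk : ∀ L {x} → WalkFromTo H L x x → ∀ u v → u ∈ map (source H) L → v ∈ map (source H) L →
    Σ (List (Step H)) λ M → All (_∈ L) M × WalkFromTo H M u v
  connected-closedWalk L walk u v u∈ v∈ with ∈-map⁻ (source H) u∈ | ∈-map⁻ (source H) v∈
  ... | b , b∈ , refl | c , c∈ , refl with suffixFrom L walk b∈ | prefixTo L walk c∈
  ... | M₁ , M₁⊆L , walk₁ | M₂ , M₂⊆L , walk₂ =
    M₁ ++ M₂ , Allₚ.++⁺ M₁⊆L M₂⊆L , walk-++ H M₁ walk₁ walk₂

  walkIsCircle : ∀ a W {x} → WalkFromTo H (a ∷ W) x x → Unique (map (source H) (a ∷ W)) →
    NoBacktrack (a ∷ W) → WalkIsCircle H (a ∷ W)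
  walkIsCircle (e , s) W walk sources-unique nb =
    edges-unique ,
    (endpt H e s , e , ∈⇒edgeSetOf ((e , s) ∷ W) (here refl) , s , refl) ,
    (λ v v∈ → degree-closedWalk L walk sources-unique edges-unique v (inVertexSet⇒∈sources (e , s) W walk v v∈)) ,
    (λ u v u∈ v∈ → Product.map₂ (Product.map₁ (All.map (∈⇒edgeSetOf L)))
                     (connected-closedWalk L walk u v (inVertexSet⇒∈sources (e , s) W walk u u∈)
                                                      (inVertexSet⇒∈sources (e , s) W walk v v∈)))
    where
    L = (e , s) ∷ W
    edges-unique = uniqueEdges L walk sources-unique nb

-- The double cover

liftFin-injective : ∀ {n} β γ (x y : Fin n) → liftFin β x ≡ liftFin γ y → β ≡ γ × x ≡ y
liftFin-injective {n} S.+ S.+ x y eq =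
  refl , Sumₚ.inj₁-injective
    (trans (sym (Finₚ.splitAt-↑ˡ n x n)) (trans (cong (splitAt n) eq) (Finₚ.splitAt-↑ˡ n y n)))
liftFin-injective {n} S.- S.- x y eq =
  refl , Sumₚ.inj₂-injective
    (trans (sym (Finₚ.splitAt-↑ʳ n n x)) (trans (cong (splitAt n) eq) (Finₚ.splitAt-↑ʳ n n y)))
liftFin-injective {n} S.+ S.- x y eq
  with trans (sym (Finₚ.splitAt-↑ˡ n x n)) (trans (cong (splitAt n) eq) (Finₚ.splitAt-↑ʳ n n y))
... | ()
liftFin-injective {n} S.- S.+ x y eq
  with trans (sym (Finₚ.splitAt-↑ʳ n n x)) (trans (cong (splitAt n) eq) (Finₚ.splitAt-↑ˡ n y n))
... | ()

liftFin-≟ : ∀ {n} β γ (x y : Fin n) →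
  does (liftFin β x ≟ liftFin γ y) ≡ does (β Signₚ.≟ γ) ∧ does (x ≟ y)
liftFin-≟ β γ x y with liftFin β x ≟ liftFin γ y | β Signₚ.≟ γ | x ≟ y
... | yes _   | yes _    | yes _   = refl
... | yes eq  | no β≢γ   | _       = ⊥-elim (β≢γ (proj₁ (liftFin-injective β γ x y eq)))
... | yes eq  | yes _    | no x≢y  = ⊥-elim (x≢y (proj₂ (liftFin-injective β γ x y eq)))
... | no  neq | yes refl | yes refl = ⊥-elim (neq refl)
... | no  _   | yes _    | no _    = refl
... | no  _   | no _     | _       = refl

if-∧ : ∀ {A : Set} b d (p q : A) → (if b ∧ d then p else q) ≡ (if b then (if d then p else q) else q)
if-∧ true  d p q = refl
if-∧ false d p q = refl

δ-liftFin : ∀ {n} β γ (x y : Fin n) →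
  δ (liftFin β x) (liftFin γ y) ≡ (if does (β Signₚ.≟ γ) then δ x y else 0)
δ-liftFin β γ x y = trans (cong (λ b → if b then 1 else 0) (liftFin-≟ β γ x y)) (if-∧ _ (does (x ≟ y)) 1 0)

δ-liftFin-± : ∀ {n} β (x y : Fin n) →
  δ (liftFin β x) (liftFin S.+ y) ℕ.+ δ (liftFin β x) (liftFin S.- y) ≡ δ x y
δ-liftFin-± S.+ x y rewrite δ-liftFin S.+ S.+ x y | δ-liftFin S.+ S.- x y = ℕₚ.+-identityʳ (δ x y)
δ-liftFin-± S.- x y rewrite δ-liftFin S.- S.+ x y | δ-liftFin S.- S.- x y = refl

*-cancel-twice : ∀ α t → (α S.* t) S.* t ≡ α
*-cancel-twice α t = trans (Signₚ.*-assoc α t t) (trans (cong (α S.*_) (Signₚ.s*s≡+ t)) (Signₚ.*-identityʳ α))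

lifted-edge-positive : ∀ β σ a b → σ ≡ S.opposite (a S.* b) →
  S.+ ≡ S.opposite (((β S.* S.+) S.* a) S.* ((β S.* σ) S.* b))
lifted-edge-positive S.- _ S.- S.- refl = refl
lifted-edge-positive S.- _ S.- S.+ refl = refl
lifted-edge-positive S.- _ S.+ S.- refl = refl
lifted-edge-positive S.- _ S.+ S.+ refl = refl
lifted-edge-positive S.+ _ S.- S.- refl = refl
lifted-edge-positive S.+ _ S.- S.+ refl = refl
lifted-edge-positive S.+ _ S.+ S.- refl = refl
lifted-edge-positive S.+ _ S.+ S.+ refl = refl

sheet-invariant : ∀ α t n → (α S.* S.opposite (S.opposite t S.* n)) S.* S.opposite n ≡ α S.* S.opposite t
sheet-invariant S.- S.- S.- = refl
sheet-invariant S.- S.- S.+ = refl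
sheet-invariant S.- S.+ S.- = refl
sheet-invariant S.- S.+ S.+ = refl
sheet-invariant S.+ S.- S.- = refl
sheet-invariant S.+ S.- S.+ = refl
sheet-invariant S.+ S.+ S.- = refl
sheet-invariant S.+ S.+ S.+ = refl

0-toℤ[opposite] : ∀ t → 0ℤ - toℤ (S.opposite t) ≡ toℤ t
0-toℤ[opposite] S.- = refl
0-toℤ[opposite] S.+ = refl

module _ (G : SignedGraph) where

  private
    D : SignedGraph
    D = doubleCover G

  unliftE-liftFin : ∀ β e → unliftE G (liftFin β e) ≡ (β , e)
  unliftE-liftFin S.+ e rewrite Finₚ.splitAt-↑ˡ (nE G) e (nE G) = refl
  unliftE-liftFin S.- e rewrite Finₚ.splitAt-↑ʳ (nE G) (nE G) e = refl

  liftFin-unliftE : ∀ e′ → liftFin (proj₁ (unliftE G e′)) (proj₂ (unliftE G e′)) ≡ e′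
  liftFin-unliftE e′ with splitAt (nE G) e′ | Finₚ.join-splitAt (nE G) (nE G) e′
  ... | inj₁ e | join≡e′ = join≡e′
  ... | inj₂ e | join≡e′ = join≡e′

  endpt-liftFin : ∀ β e s → endpt D (liftFin β e) s ≡ liftFin (β S.* sideSign G e s) (endpt G e s)
  endpt-liftFin β e s rewrite unliftE-liftFin β e = refl

  liftEnds-liftFin : ∀ ω β e s → liftEnds G ω (liftFin β e) s ≡ (β S.* sideSign G e s) S.* ω e s
  liftEnds-liftFin ω β e s rewrite unliftE-liftFin β e = refl

  sideSign-product : ∀ e s → sideSign G e s S.* sideSign G e (not s) ≡ σ G e
  sideSign-product e false = refl
  sideSign-product e true  = Signₚ.*-identityʳ (σ G e)

  sheet-other-end : ∀ α e s → (α S.* sideSign G e s) S.* sideSign G e (not s) ≡ α S.* σ G e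
  sheet-other-end α e s =
    trans (Signₚ.*-assoc α (sideSign G e s) (sideSign G e (not s))) (cong (α S.*_) (sideSign-product e s))

  source-lift : ∀ α e s → source D (liftFin (α S.* sideSign G e s) e , s) ≡ liftFin α (endpt G e s)
  source-lift α e s = trans (endpt-liftFin (α S.* sideSign G e s) e s)
                            (cong (λ β → liftFin β (endpt G e s)) (*-cancel-twice α (sideSign G e s)))

  target-lift : ∀ α e s → target D (liftFin (α S.* sideSign G e s) e , s) ≡ liftFin (α S.* σ G e) (endpt G e (not s))
  target-lift α e s = trans (endpt-liftFin (α S.* sideSign G e s) e (not s))
                            (cong (λ β → liftFin β (endpt G e (not s))) (sheet-other-end α e s))

  outSign-lift : ∀ τ α e s → liftEnds G τ (liftFin (α S.* sideSign G e s) e) s ≡ α S.* τ e s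
  outSign-lift τ α e s = trans (liftEnds-liftFin τ (α S.* sideSign G e s) e s)
                               (cong (S._* τ e s) (*-cancel-twice α (sideSign G e s)))

  inSign-lift : ∀ τ α e s → liftEnds G τ (liftFin (α S.* sideSign G e s) e) (not s) ≡ (α S.* σ G e) S.* τ e (not s)
  inSign-lift τ α e s = trans (liftEnds-liftFin τ (α S.* sideSign G e s) e (not s))
                              (cong (S._* τ e (not s)) (sheet-other-end α e s))

  walkFromTo-lift : ∀ α W {x y} → WalkFromTo G W x y →
    WalkFromTo D (liftWalk G α W) (liftFin α x) (liftFin (α S.* walkSign G W) y)
  walkFromTo-lift α [] {x} refl = cong (λ β → liftFin β x) (sym (Signₚ.*-identityʳ α))
  walkFromTo-lift α ((e , s) ∷ W) {y = y} (refl , walk) =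
    source-lift α e s ,
    subst₂ (WalkFromTo D (liftWalk G (α S.* σ G e) W)) (sym (target-lift α e s))
           (cong (λ β → liftFin β y) (Signₚ.*-assoc α (σ G e) (walkSign G W)))
           (walkFromTo-lift (α S.* σ G e) W walk)

  coherentBetween-lift : ∀ τ α t W u → CoherentBetween G τ t W u →
    CoherentBetween D (liftEnds G τ) (α S.* t) (liftWalk G α W) ((α S.* walkSign G W) S.* u)
  coherentBetween-lift τ α t [] u refl =
    trans (cong (S._* S.opposite t) (Signₚ.*-identityʳ α)) (*-opposite α t)
  coherentBetween-lift τ α t ((e , s) ∷ W) u (out≡-t , coh) =
    trans (outSign-lift τ α e s) (trans (cong (α S.*_) out≡-t) (*-opposite α t)) ,
    subst₂ (λ t′ u′ → CoherentBetween D (liftEnds G τ) t′ (liftWalk G (α S.* σ G e) W) u′)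
           (sym (inSign-lift τ α e s))
           (cong (S._* u) (Signₚ.*-assoc α (σ G e) (walkSign G W)))
           (coherentBetween-lift τ (α S.* σ G e) (τ e (not s)) W u coh)

  directedClosedWalk-lift : ∀ τ → IsOrientation G τ → ∀ α W → DirectedClosedWalk G τ W →
    DirectedClosedWalk D (liftEnds G τ) (liftWalk G α W)
  directedClosedWalk-lift τ τ-or α ((e , s) ∷ W) closed =
    directedClosedWalk⁺ D (liftEnds G τ) (liftFin (α S.* sideSign G e s) e , s) (liftWalk G α′ W)
      (subst₂ (WalkFromTo D (liftWalk G α′ W)) (sym (target-lift α e s))
              (trans (cong (λ β → liftFin β (endpt G e s)) returns) (sym (source-lift α e s)))
              (walkFromTo-lift α′ W walk))
      (subst₂ (λ t u → CoherentBetween D (liftEnds G τ) t (liftWalk G α′ W) u)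
              (sym (inSign-lift τ α e s)) (trans (cong (S._* τ e s) returns) (sym (outSign-lift τ α e s)))
              (coherentBetween-lift τ α′ (τ e (not s)) W (τ e s) coh))
    where
    α′ = α S.* σ G e
    walk = proj₁ (directedClosedWalk⁻ G τ (e , s) W closed)
    coh  = proj₂ (directedClosedWalk⁻ G τ (e , s) W closed)
    returns : α′ S.* walkSign G W ≡ α
    returns = trans (Signₚ.*-assoc α (σ G e) (walkSign G W))
                    (trans (cong (α S.*_) (walkSign-directedClosedWalk G τ τ-or ((e , s) ∷ W) closed))
                           (Signₚ.*-identityʳ α))

  liftEnds-isOrientation : ∀ ω → IsOrientation G ω → IsOrientation D (liftEnds G ω)
  liftEnds-isOrientation ω ω-or e′ =
    subst (λ z → S.+ ≡ S.opposite (liftEnds G ω z false S.* liftEnds G ω z true)) (liftFin-unliftE e′)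
          (lifted (proj₁ (unliftE G e′)) (proj₂ (unliftE G e′)))
    where
    lifted : ∀ β e → S.+ ≡ S.opposite (liftEnds G ω (liftFin β e) false S.* liftEnds G ω (liftFin β e) true)
    lifted β e rewrite liftEnds-liftFin ω β e false | liftEnds-liftFin ω β e true =
      lifted-edge-positive β (σ G e) (ω e false) (ω e true) (ω-or e)

  -- α times the sign of τ at the departing end is invariant along a coherent walk, so the
  -- sheet of each vertex of the lift is determined by the sign with which the walk leaves it
  sources-lift : ∀ τ → IsOrientation G τ → ∀ α t W u → CoherentBetween G τ t W u →
    map (source D) (liftWalk G α W) ≡
    map (λ b → liftFin ((α S.* S.opposite t) S.* outSign G τ b) (source G b)) W
  sources-lift τ τ-or α t []            u _               = refl
  sources-lift τ τ-or α t ((e , s) ∷ W) u (out≡-t , coh) = cong₂ _∷_ first rest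
    where
    open ≡-Reasoning
    first : source D (liftFin (α S.* sideSign G e s) e , s) ≡ liftFin ((α S.* S.opposite t) S.* τ e s) (endpt G e s)
    first = trans (source-lift α e s) (cong (λ β → liftFin β (endpt G e s))
                  (sym (trans (cong ((α S.* S.opposite t) S.*_) out≡-t) (*-cancel-twice α (S.opposite t)))))
    invariant : (α S.* σ G e) S.* S.opposite (τ e (not s)) ≡ α S.* S.opposite t
    invariant = begin
      (α S.* σ G e) S.* S.opposite (τ e (not s))
        ≡⟨ cong (λ z → (α S.* z) S.* S.opposite (τ e (not s))) (σ-orientation G τ τ-or e s) ⟩
      (α S.* S.opposite (τ e s S.* τ e (not s))) S.* S.opposite (τ e (not s))
        ≡⟨ cong (λ z → (α S.* S.opposite (z S.* τ e (not s))) S.* S.opposite (τ e (not s))) out≡-t ⟩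
      (α S.* S.opposite (S.opposite t S.* τ e (not s))) S.* S.opposite (τ e (not s))
        ≡⟨ sheet-invariant α t (τ e (not s)) ⟩
      α S.* S.opposite t ∎
    rest = trans (sources-lift τ τ-or (α S.* σ G e) (τ e (not s)) W u coh)
                 (cong (λ κ → map (λ b → liftFin (κ S.* outSign G τ b) (source G b)) W) invariant)

  coupling-lift : ∀ ω τ β e → coupling D (liftEnds G ω) (liftEnds G τ) (liftFin β e) ≡ coupling G ω τ e
  coupling-lift ω τ β e = begin
    toℤ (liftEnds G ω (liftFin β e) false) * toℤ (liftEnds G τ (liftFin β e) false)
      ≡⟨ cong₂ (λ a b → toℤ a * toℤ b) (liftEnds-liftFin ω β e false) (liftEnds-liftFin τ β e false) ⟩
    toℤ (k S.* ω e false) * toℤ (k S.* τ e false)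
      ≡⟨ cong₂ _*_ (toℤ-* k (ω e false)) (toℤ-* k (τ e false)) ⟩
    (toℤ k * toℤ (ω e false)) * (toℤ k * toℤ (τ e false))
      ≡⟨ unit-*-* (toℤ k) (toℤ-square k) (toℤ (ω e false)) (toℤ (τ e false)) ⟩
    coupling G ω τ e ∎
    where
    open ≡-Reasoning
    k = β S.* S.+

  walkFlow-liftFin : ∀ ω τ L β e →
    walkFlow D (liftEnds G ω) (liftEnds G τ) L (liftFin β e) ≡ coupling G ω τ e * + count D L (liftFin β e)
  walkFlow-liftFin ω τ L β e =
    trans (walkFlow-count D (liftEnds G ω) (liftEnds G τ) L (liftFin β e))
          (cong (_* + count D L (liftFin β e)) (coupling-lift ω τ β e))

  count-lift : ∀ α W e →
    count D (liftWalk G α W) (liftFin S.+ e) ℕ.+ count D (liftWalk G α W) (liftFin S.- e) ≡ count G W e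
  count-lift α []             e = refl
  count-lift α ((e₁ , s) ∷ W) e =
    trans (ℕ-interchange (δ ẽ₁ (liftFin S.+ e)) (count D L (liftFin S.+ e))
                         (δ ẽ₁ (liftFin S.- e)) (count D L (liftFin S.- e)))
          (cong₂ ℕ._+_ (δ-liftFin-± (α S.* sideSign G e₁ s) e₁ e) (count-lift (α S.* σ G e₁) W e))
    where
    ẽ₁ = liftFin (α S.* sideSign G e₁ s) e₁
    L  = liftWalk G (α S.* σ G e₁) W

  project-walkFlow-lift : ∀ ω τ α W e →
    project G (walkFlow D (liftEnds G ω) (liftEnds G τ) (liftWalk G α W)) e ≡ walkFlow G ω τ W e
  project-walkFlow-lift ω τ α W e = begin
    walkFlow D (liftEnds G ω) (liftEnds G τ) L (liftFin S.+ e) + walkFlow D (liftEnds G ω) (liftEnds G τ) L (liftFin S.- e)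
      ≡⟨ cong₂ _+_ (walkFlow-liftFin ω τ L S.+ e) (walkFlow-liftFin ω τ L S.- e) ⟩
    u * + count D L (liftFin S.+ e) + u * + count D L (liftFin S.- e)
      ≡⟨ sym (ℤₚ.*-distribˡ-+ u (+ count D L (liftFin S.+ e)) (+ count D L (liftFin S.- e))) ⟩
    u * (+ count D L (liftFin S.+ e) + + count D L (liftFin S.- e))
      ≡⟨ cong (u *_) (trans (sym (ℤₚ.pos-+ (count D L (liftFin S.+ e)) _)) (cong +_ (count-lift α W e))) ⟩
    u * + count G W e
      ≡⟨ sym (walkFlow-count G ω τ W e) ⟩
    walkFlow G ω τ W e ∎
    where
    open ≡-Reasoning
    L = liftWalk G α W
    u = coupling G ω τ e

  signAt-liftFin : ∀ x t γ β v →
    signAt D (liftFin γ x) t (liftFin β v) ≡ (if does (γ Signₚ.≟ β) then signAt G x t v else 0ℤ)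
  signAt-liftFin x t γ β v =
    trans (cong (λ b → if b then toℤ t else 0ℤ) (liftFin-≟ γ β x v)) (if-∧ _ (does (x ≟ v)) (toℤ t) 0ℤ)

  signAt-lift : ∀ γ x t v →
    signAt D (liftFin γ x) (γ S.* t) (liftFin S.+ v) - signAt D (liftFin γ x) (γ S.* t) (liftFin S.- v) ≡ signAt G x t v
  signAt-lift S.+ x t v rewrite signAt-liftFin x t S.+ S.+ v | signAt-liftFin x t S.+ S.- v = ℤₚ.+-identityʳ _
  signAt-lift S.- x t v rewrite signAt-liftFin x (S.opposite t) S.- S.+ v | signAt-liftFin x (S.opposite t) S.- S.- v
    with does (x ≟ v)
  ... | true  = 0-toℤ[opposite] t
  ... | false = refl

  incidence-lift : ∀ ω β v e →
    incidence D (liftEnds G ω) (liftFin S.+ v) (liftFin β e) - incidence D (liftEnds G ω) (liftFin S.- v) (liftFin β e)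
    ≡ incidence G ω v e
  incidence-lift ω β v e = begin
    incidence D (liftEnds G ω) (liftFin S.+ v) (liftFin β e) - incidence D (liftEnds G ω) (liftFin S.- v) (liftFin β e)
      ≡⟨ cong₂ _-_ (ends (liftFin S.+ v)) (ends (liftFin S.- v)) ⟩
    (A (liftFin S.+ v) + B (liftFin S.+ v)) - (A (liftFin S.- v) + B (liftFin S.- v))
      ≡⟨ regroup (A (liftFin S.+ v)) (B (liftFin S.+ v)) (A (liftFin S.- v)) (B (liftFin S.- v)) ⟩
    (A (liftFin S.+ v) - A (liftFin S.- v)) + (B (liftFin S.+ v) - B (liftFin S.- v))
      ≡⟨ cong₂ _+_ (signAt-lift (β S.* S.+) (endpt G e false) (ω e false) v)
                   (signAt-lift (β S.* σ G e) (endpt G e true) (ω e true) v) ⟩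
    incidence G ω v e ∎
    where
    open ≡-Reasoning
    A B : Vtx D → ℤ
    A w = signAt D (liftFin (β S.* S.+) (endpt G e false)) ((β S.* S.+) S.* ω e false) w
    B w = signAt D (liftFin (β S.* σ G e) (endpt G e true)) ((β S.* σ G e) S.* ω e true) w
    ends : ∀ w → incidence D (liftEnds G ω) w (liftFin β e) ≡ A w + B w
    ends w = cong₂ _+_ (cong₂ (λ x t → signAt D x t w) (endpt-liftFin β e false) (liftEnds-liftFin ω β e false))
                       (cong₂ (λ x t → signAt D x t w) (endpt-liftFin β e true) (liftEnds-liftFin ω β e true))
    regroup : ∀ a b c d → (a + b) - (c + d) ≡ (a - c) + (b - d)
    regroup = solve-∀

  divergence-project : ∀ ω g v → divergence G ω (project G g) v ≡
    divergence D (liftEnds G ω) g (liftFin S.+ v) - divergence D (liftEnds G ω) g (liftFin S.- v)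
  divergence-project ω g v = begin
    Σℤ (λ e → incidence G ω v e * (g (liftFin S.+ e) + g (liftFin S.- e)))
      ≡⟨ Σℤ-cong split ⟩
    Σℤ (λ e → X (liftFin S.+ v) e - X (liftFin S.- v) e)
      ≡⟨ Σℤ-- (X (liftFin S.+ v)) (X (liftFin S.- v)) ⟩
    Σℤ (X (liftFin S.+ v)) - Σℤ (X (liftFin S.- v))
      ≡⟨ cong₂ _-_ (ΣX (liftFin S.+ v)) (ΣX (liftFin S.- v)) ⟩
    divergence D (liftEnds G ω) g (liftFin S.+ v) - divergence D (liftEnds G ω) g (liftFin S.- v) ∎
    where
    open ≡-Reasoning
    K : Vtx D → Edge D → ℤ
    K = incidence D (liftEnds G ω)
    X : Vtx D → Edge G → ℤ
    X w e = K w (liftFin S.+ e) * g (liftFin S.+ e) + K w (liftFin S.- e) * g (liftFin S.- e)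
    ΣX : ∀ w → Σℤ (X w) ≡ divergence D (liftEnds G ω) g w
    ΣX w = trans (Σℤ-+ {nE G} (λ e → K w (liftFin S.+ e) * g (liftFin S.+ e))
                              (λ e → K w (liftFin S.- e) * g (liftFin S.- e)))
                 (sym (Σℤ-↑ (nE G) (nE G) (λ e′ → K w e′ * g e′)))
    distribute : ∀ a b c d p q → (a - b) * p + (c - d) * q ≡ (a * p + c * q) - (b * p + d * q)
    distribute = solve-∀
    split : ∀ e → incidence G ω v e * (g (liftFin S.+ e) + g (liftFin S.- e)) ≡ X (liftFin S.+ v) e - X (liftFin S.- v) e
    split e = begin
      incidence G ω v e * (g (liftFin S.+ e) + g (liftFin S.- e))
        ≡⟨ ℤₚ.*-distribˡ-+ (incidence G ω v e) (g (liftFin S.+ e)) (g (liftFin S.- e)) ⟩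
      incidence G ω v e * g (liftFin S.+ e) + incidence G ω v e * g (liftFin S.- e)
        ≡⟨ cong₂ (λ a b → a * g (liftFin S.+ e) + b * g (liftFin S.- e))
                 (sym (incidence-lift ω S.+ v e)) (sym (incidence-lift ω S.- v e)) ⟩
      (K (liftFin S.+ v) (liftFin S.+ e) - K (liftFin S.- v) (liftFin S.+ e)) * g (liftFin S.+ e) +
      (K (liftFin S.+ v) (liftFin S.- e) - K (liftFin S.- v) (liftFin S.- e)) * g (liftFin S.- e)
        ≡⟨ distribute (K (liftFin S.+ v) (liftFin S.+ e)) (K (liftFin S.- v) (liftFin S.+ e))
                      (K (liftFin S.+ v) (liftFin S.- e)) (K (liftFin S.- v) (liftFin S.- e))
                      (g (liftFin S.+ e)) (g (liftFin S.- e)) ⟩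
      X (liftFin S.+ v) e - X (liftFin S.- v) e ∎

  isFlow-project : ∀ ω g → IsFlow D (liftEnds G ω) g → IsFlow G ω (project G g)
  isFlow-project ω g g-flow = divergence≡0⇒isFlow G ω (project G g) λ v →
    trans (divergence-project ω g v)
          (cong₂ _-_ (isFlow⇒divergence≡0 D (liftEnds G ω) g g-flow (liftFin S.+ v))
                     (isFlow⇒divergence≡0 D (liftEnds G ω) g g-flow (liftFin S.- v)))

  project-signed : ∀ (u : Edge G → ℤ) g → (∀ β e → 0ℤ ≤ u e * g (liftFin β e)) →
    ∀ e → 0ℤ ≤ u e * project G g e
  project-signed u g ug≥0 e =
    subst (0ℤ ≤_) (sym (ℤₚ.*-distribˡ-+ (u e) (g (liftFin S.+ e)) (g (liftFin S.- e))))
          (ℤₚ.+-mono-≤ (ug≥0 S.+ e) (ug≥0 S.- e))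

  -- all lifts of an edge carry the sign u, so they cannot cancel in the projection
  project-nonZero : ∀ (u : Edge G → ℤ) → (∀ e → u e * u e ≡ + 1) → ∀ g →
    (∀ β e → 0ℤ ≤ u e * g (liftFin β e)) → NonZero D g → NonZero G (project G g)
  project-nonZero u u²≡1 g ug≥0 g≢0 πg≡0 =
    g≢0 λ e′ → subst (λ z → g z ≡ 0ℤ) (liftFin-unliftE e′)
                     (vanishes (proj₁ (unliftE G e′)) (proj₂ (unliftE G e′)))
    where
    u-sum : ∀ e → u e * g (liftFin S.+ e) + u e * g (liftFin S.- e) ≡ 0ℤ
    u-sum e = trans (sym (ℤₚ.*-distribˡ-+ (u e) (g (liftFin S.+ e)) (g (liftFin S.- e))))
                    (trans (cong (u e *_) (πg≡0 e)) (ℤₚ.*-zeroʳ (u e)))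
    cancel : ∀ β e → u e * g (liftFin β e) ≡ 0ℤ → g (liftFin β e) ≡ 0ℤ
    cancel β e ug≡0 = unit-*-injective (u e) (u²≡1 e) (trans ug≡0 (sym (ℤₚ.*-zeroʳ (u e))))
    vanishes : ∀ β e → g (liftFin β e) ≡ 0ℤ
    vanishes S.+ e = cancel S.+ e (nonNegative-+-≡0 (ug≥0 S.+ e) (ug≥0 S.- e) (u-sum e))
    vanishes S.- e = cancel S.- e (nonNegative-+-≡0 (ug≥0 S.- e) (ug≥0 S.+ e)
                                     (trans (ℤₚ.+-comm (u e * g (liftFin S.- e)) _) (u-sum e)))

  -- u is a sign pattern shared by all lifts of an edge; it is inherited by both parts of a
  -- conformal decomposition of the lift, which therefore projects to one of f
  confIndecomposable-lift : ∀ ω f F̃ (u : Edge G → ℤ) → (∀ e → u e * u e ≡ + 1) →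
    (∀ β e → 0ℤ ≤ u e * F̃ (liftFin β e)) → IsLiftOf G ω F̃ f → ConfIndecomposable G ω f →
    ConfIndecomposable D (liftEnds G ω) F̃
  confIndecomposable-lift ω f F̃ u u²≡1 uF̃≥0 (F̃-flow , πF̃≡f) (_ , f≢0 , indecomposable) =
    F̃-flow , F̃≢0 , indecomposable ∘ projectDecomposition
    where
    F̃≢0 : NonZero D F̃
    F̃≢0 F̃≡0 = f≢0 λ e → trans (sym (πF̃≡f e)) (cong₂ _+_ (F̃≡0 (liftFin S.+ e)) (F̃≡0 (liftFin S.- e)))

    signed : ∀ g₁ g₂ → (∀ e′ → F̃ e′ ≡ g₁ e′ + g₂ e′) → (∀ e′ → 0ℤ ≤ g₁ e′ * g₂ e′) →
      ∀ β e → 0ℤ ≤ u e * g₁ (liftFin β e)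
    signed g₁ g₂ F̃≡g₁+g₂ g₁g₂≥0 β e =
      unit-*-summand-nonNegative (u e) (u²≡1 e) (g₁ (liftFin β e)) (g₂ (liftFin β e)) (g₁g₂≥0 (liftFin β e))
        (subst (λ z → 0ℤ ≤ u e * z) (F̃≡g₁+g₂ (liftFin β e)) (uF̃≥0 β e))

    projectDecomposition : ConformalDecomposition D (liftEnds G ω) F̃ → ConformalDecomposition G ω f
    projectDecomposition (g₁ , g₂ , g₁-flow , g₂-flow , g₁≢0 , g₂≢0 , F̃≡g₁+g₂ , g₁g₂≥0) =
      project G g₁ , project G g₂ , isFlow-project ω g₁ g₁-flow , isFlow-project ω g₂ g₂-flow ,
      project-nonZero u u²≡1 g₁ ug₁≥0 g₁≢0 , project-nonZero u u²≡1 g₂ ug₂≥0 g₂≢0 , f≡πg₁+πg₂ , πg₁πg₂≥0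
      where
      F̃≡g₂+g₁ : ∀ e′ → F̃ e′ ≡ g₂ e′ + g₁ e′
      F̃≡g₂+g₁ e′ = trans (F̃≡g₁+g₂ e′) (ℤₚ.+-comm (g₁ e′) (g₂ e′))
      ug₁≥0 = signed g₁ g₂ F̃≡g₁+g₂ g₁g₂≥0
      ug₂≥0 = signed g₂ g₁ F̃≡g₂+g₁ (λ e′ → subst (0ℤ ≤_) (ℤₚ.*-comm (g₁ e′) (g₂ e′)) (g₁g₂≥0 e′))
      f≡πg₁+πg₂ : ∀ e → f e ≡ project G g₁ e + project G g₂ e
      f≡πg₁+πg₂ e = trans (sym (πF̃≡f e))
        (trans (cong₂ _+_ (F̃≡g₁+g₂ (liftFin S.+ e)) (F̃≡g₁+g₂ (liftFin S.- e)))
               (interchange (g₁ (liftFin S.+ e)) (g₂ (liftFin S.+ e)) (g₁ (liftFin S.- e)) (g₂ (liftFin S.- e))))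
      πg₁πg₂≥0 : ∀ e → 0ℤ ≤ project G g₁ e * project G g₂ e
      πg₁πg₂≥0 e = subst (0ℤ ≤_) (unit-*-* (u e) (u²≡1 e) (project G g₁ e) (project G g₂ e))
                         (*-nonNegative (project-signed u g₁ ug₁≥0 e) (project-signed u g₂ ug₂≥0 e))

  liftWalk-isCircle : ∀ τ → IsOrientation G τ → ∀ W → DirectedClosedWalk G τ W →
    (∀ P q Q r R → W ≡ P ++ q ∷ Q ++ r ∷ R → source G q ≡ source G r → outSign G τ q ≢ outSign G τ r) →
    ∀ α → WalkIsCircle D (liftWalk G α W)
  liftWalk-isCircle τ τ-or ((e , s) ∷ W) closed departures-distinct α =
    walkIsCircle D ẽ L (proj₁ closedLift) uniqueSources
      (coherentBetween⇒noBacktrack D (liftEnds G τ) ẽ L _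
        (proj₂ (directedClosedWalk⁻ D (liftEnds G τ) ẽ L closedLift)))
    where
    ẽ = liftFin (α S.* sideSign G e s) e , s
    L = liftWalk G (α S.* σ G e) W
    closedLift = directedClosedWalk-lift τ τ-or α ((e , s) ∷ W) closed
    uniqueSources : Unique (map (source D) (ẽ ∷ L))
    uniqueSources with directedClosedWalk⇒coherentBetween G τ ((e , s) ∷ W) closed
    ... | t , u , coh = subst Unique (sym (sources-lift τ τ-or α t ((e , s) ∷ W) u coh))
      (unique-map _ ((e , s) ∷ W) λ P q Q r R W≡ lifts≡ →
        let sheets≡ , sources≡ = liftFin-injective _ _ (source G q) (source G r) lifts≡
        in departures-distinct P q Q r R W≡ sources≡ (Signₚ.*-cancelˡ-≡ (α S.* S.opposite t) _ _ sheets≡))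

  walkFlow-lift-isLiftOf : ∀ ω τ → IsOrientation G ω → IsOrientation G τ → ∀ f W → DirectedClosedWalk G τ W →
    (∀ e → f e ≡ walkFlow G ω τ W e) → ∀ α →
    IsLiftOf G ω (walkFlow D (liftEnds G ω) (liftEnds G τ) (liftWalk G α W)) f
  walkFlow-lift-isLiftOf ω τ ω-or τ-or f W closed f≡W α =
    walkFlow-isFlow D (liftEnds G ω) (liftEnds G τ) (liftEnds-isOrientation ω ω-or) (liftEnds-isOrientation τ τ-or)
                    (liftWalk G α W) (directedClosedWalk-lift τ τ-or α W closed) ,
    λ e → trans (project-walkFlow-lift ω τ α W e) (sym (f≡W e))

  walkFlow-lift-signed : ∀ ω τ W α β e →
    0ℤ ≤ coupling G ω τ e * walkFlow D (liftEnds G ω) (liftEnds G τ) (liftWalk G α W) (liftFin β e)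
  walkFlow-lift-signed ω τ W α β e =
    subst (0ℤ ≤_) (sym (trans (cong (coupling G ω τ e *_) (walkFlow-liftFin ω τ (liftWalk G α W) β e))
                              (unit-*-cancel (coupling G ω τ e) (coupling-square G ω τ e) _)))
          (ℤ.+≤+ ℕ.z≤n)

theorem4p5 : (G : SignedGraph) (ω : EndSigns G) → IsOrientation G ω →
    (f : Edge G → ℤ) → ConfIndecomposable G ω f →
    Σ (List (Step G)) λ W →
      DirectedClosedWalk G (orientFlow G ω f) W ×
      walkSign G W ≡ Sign.+ ×
      OnSupport G f W ×
      (∀ e → f e ≡ walkFlow G ω (orientFlow G ω f) W e) ×
      (∀ (α : Sign) →
        WalkIsCircle (doubleCover G) (liftWalk G α W) ×
        IsLiftOf G ω (walkFlow (doubleCover G) (liftEnds G ω) (liftEnds G (orientFlow G ω f)) (liftWalk G α W)) f ×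
        ConfIndecomposable (doubleCover G) (liftEnds G ω) (walkFlow (doubleCover G) (liftEnds G ω) (liftEnds G (orientFlow G ω f)) (liftWalk G α W)))
theorem4p5 G ω ω-or f ci =
  W , closed , walkSign-directedClosedWalk G τ τ-or W closed , onSupport-count G f W W≤∣f∣ , f≡W ,
  λ α → liftWalk-isCircle G τ τ-or W closed (departures-distinct G ω f ω-or ci W closed W≤∣f∣) α ,
        isLift α ,
        confIndecomposable-lift G ω f (walkFlow (doubleCover G) (liftEnds G ω) (liftEnds G τ) (liftWalk G α W))
          (coupling G ω τ) (coupling-square G ω τ) (walkFlow-lift-signed G ω τ W α) (isLift α) ci
  where
  τ      = orientFlow G ω f
  τ-or   = orientFlow-isOrientation G ω f ω-or
  W      = proj₁ (carrierWalk G ω f ω-or ci)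
  closed = proj₁ (proj₂ (carrierWalk G ω f ω-or ci))
  W≤∣f∣  = proj₂ (proj₂ (carrierWalk G ω f ω-or ci))
  f≡W    = confIndecomposable⇒≡walkFlow G ω f ω-or ci W closed W≤∣f∣
  isLift = walkFlow-lift-isLiftOf G ω τ ω-or τ-or f W closed f≡W
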